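{- Let $T$ be an $r$-row (possibly skew) fluctuating tableau of length $n$. The following are equivalent: (i) $\mathcal E(T)=\varepsilon(T)$; (ii) $\mathcal E^*(T)=\varepsilon(T)$. Moreover, (i) and (ii) imply the following two conditions, which are equivalent to each other: (a) $\mathcal E(T)=\mathcal E^*(T)$; (b) $\mathcal P^n(T)=T$.
   Context: An $r$-row generalized partition is $\lambda\in\mathbb Z^r$ with $\lambda_1\ge\cdots\ge\lambda_r$. $\mathcal A_r$ is the set of subsets $S\subseteq\{\pm1,\ldots,\pm r\}$ with all elements of the same sign (including $\emptyset$); $\mathbf e_S=\sum_{s\in S}\mathbf e_s$ if $S$ is positive and $-\sum_{s\in S}\mathbf e_{ -s}$ if negative. An $r$-row (skew) fluctuating tableau of length $n$ is any sequence $T=(\lambda^0,\ldots,\lambda^n)$ of $r$-row generalized partitions with $\lambda^k-\lambda^{k-1}=\mathbf e_{S_k}$, $S_k\in\mathcal A_r$. $\mathrm{sort}(\alpha)$ is the weakly decreasing rearrangement; for $\alpha=(\alpha_1,\ldots,\alpha_r)$, $\mathrm{rev}(\alpha)=(\alpha_r,\ldots,\alpha_1)$. $\varepsilon(T)=(\mathrm{rev}(-\lambda^n),\mathrm{rev}(-\lambda^{n-1}),\ldots,\mathrm{rev}(-\lambda^0))$. Promotion and evacuation: $(\lambda^{i,j})_{0\le i\le n,\,i\le j\le n+i}$ with $\lambda^{0,j}=\lambda^j$, $\lambda^{i,i}=\lambda^0$, $\lambda^{i,n+i}=\lambda^n$, and $\lambda^{i,j}=\mathrm{sort}(\lambda^{i-1,j}+\lambda^{i,j-1}-\lambda^{i-1,j-1})$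 for $1\le i\le n$, $i<j<n+i$ (increasing $i$, then $j$); $\mathcal P(T)=(\lambda^{1,1},\ldots,\lambda^{1,n+1})$ and $\mathcal E(T)=(\lambda^{n,n},\lambda^{n-1,n},\ldots,\lambda^{0,n})$. Dual evacuation: $(\mu^{i,j})_{ -n\le i\le0,\,0\le j\le n+i}$ with $\mu^{0,j}=\lambda^j$, $\mu^{i,n+i}=\lambda^n$ for $-n\le i\le-1$, and $\mu^{i-1,j-1}=\mathrm{sort}(\mu^{i-1,j}+\mu^{i,j-1}-\mu^{i,j})$ for $-n+1\le i\le0$, $1\le j\le n+i-1$ (decreasing $i$, then decreasing $j$); $\mathcal E^*(T)=(\mu^{0,0},\mu^{ -1,0},\ldots,\mu^{ -n,0})$. -}

module Defs where

open import Data.Nat using (ℕ; zero; suc; _∸_)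
open import Data.Integer using (ℤ; _+_; _-_; -_; _≤_; _≤?_; 0ℤ; 1ℤ; -1ℤ)
open import Data.Fin using (Fin)
import Data.Fin as Fin
open import Data.Bool using (true; false)
open import Data.Vec using (Vec; []; _∷_; lookup; zipWith; replicate; reverse)
import Data.Vec as Vec

open import Data.Fin.Subset using (Subset)
open import Data.List using (List; []; _∷_; length; upTo)
import Data.List as List
open import Data.Product using (Σ; _×_; ∃)
open import Relation.Nullary using (yes; no)
open import Relation.Binary.PropositionalEquality using (_≡_)

Vecℤ : ℕ → Set
Vecℤ r = Vec ℤ r

IsGenPartition : {r : ℕ} → Vecℤ r → Set
IsGenPartition {r} v = (i j : Fin r) → i Fin.≤ j → lookup v j ≤ lookup v i

_⊕_ : {r : ℕ} → Vecℤ r → Vecℤ r → Vecℤ r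
_⊕_ = zipWith _+_

_⊖_ : {r : ℕ} → Vecℤ r → Vecℤ r → Vecℤ r
_⊖_ = zipWith _-_

-- Sign of an element S of A_r (the empty set is covered by either sign)
data Sign : Set where
  pos neg : Sign

-- e_S for S ∈ A_r, represented by a sign and a subset S ⊆ {1..r}
-- (S positive: sum of e_s; S negative: minus the sum of e_s)
e : {r : ℕ} → Sign → Subset r → Vecℤ r
e pos S = Vec.map (λ { true → 1ℤ ; false → 0ℤ }) S
e neg S = Vec.map (λ { true → -1ℤ ; false → 0ℤ }) S

Steps : {r : ℕ} → List (Vecℤ r) → Set
Steps [] = Data.Unit.⊤ where import Data.Unit
Steps (x ∷ []) = Data.Unit.⊤ where import Data.Unit
Steps (x ∷ y ∷ rest) =
  (Σ Sign λ σ → Σ (Subset _) λ S → y ≡ x ⊕ e σ S) × Steps (y ∷ rest)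

AllPartitions : {r : ℕ} → List (Vecℤ r) → Set
AllPartitions [] = Data.Unit.⊤ where import Data.Unit
AllPartitions (x ∷ xs) = IsGenPartition x × AllPartitions xs

IsFluctuatingTableau : (r n : ℕ) → List (Vecℤ r) → Set
IsFluctuatingTableau r n T = (length T ≡ suc n) × AllPartitions T × Steps T

insertDesc : {m : ℕ} → ℤ → Vec ℤ m → Vec ℤ (suc m)
insertDesc x [] = x ∷ []
insertDesc x (y ∷ ys) with y ≤? x
... | yes _ = x ∷ y ∷ ys
... | no  _ = y ∷ insertDesc x ys

sort : {m : ℕ} → Vec ℤ m → Vec ℤ m
sort [] = []
sort (x ∷ xs) = insertDesc x (sort xs)

rev : {r : ℕ} → Vecℤ r → Vecℤ r
rev = reverse

neg' : {r : ℕ} → Vecℤ r → Vecℤ r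
neg' = Vec.map (λ z → - z)

epsilon : {r : ℕ} → List (Vecℤ r) → List (Vecℤ r)
epsilon T = List.reverse (List.map (λ v → rev (neg' v)) T)

-- One step of the promotion growth diagram: from row i-1 (ν_0,…,ν_n)
-- to row i (μ_0,…,μ_n) with μ_0 = ν_0 (= λ^0), μ_n = ν_n (= λ^n),
-- μ_k = sort(ν_{k+1} + μ_{k-1} - ν_k) for 0 < k < n.
promGo : {r : ℕ} → Vecℤ r → List (Vecℤ r) → List (Vecℤ r)
promGo prev [] = []
promGo prev (a ∷ []) = a ∷ []
promGo prev (a ∷ b ∷ rest) = let m = sort ((b ⊕ prev) ⊖ a) in m ∷ promGo m (b ∷ rest)

promotion : {r : ℕ} → List (Vecℤ r) → List (Vecℤ r)
promotion [] = []
promotion (x ∷ rest) = x ∷ promGo x rest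

iter : {A : Set} → ℕ → (A → A) → A → A
iter zero f a = a
iter (suc k) f a = f (iter k f a)

-- list indexing with a default (only used at in-range indices)
nthD : {A : Set} → A → List A → ℕ → A
nthD d [] k = d
nthD d (x ∷ xs) zero = x
nthD d (x ∷ xs) (suc k) = nthD d xs k

zeroV : {r : ℕ} → Vecℤ r
zeroV = replicate _ 0ℤ

-- λ^{i,j} = entry (j - i) of row i = P^i(T)
grid : {r : ℕ} → List (Vecℤ r) → ℕ → ℕ → Vecℤ r
grid T i j = nthD zeroV (iter i promotion T) (j ∸ i)

-- E(T) = (λ^{n,n}, λ^{n-1,n}, …, λ^{0,n})
evacuation : {r : ℕ} → ℕ → List (Vecℤ r) → List (Vecℤ r)
evacuation n T = List.map (λ k → grid T (n ∸ k) n) (upTo (suc n))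

-- One step of the dual-evacuation diagram: from row i (μ^{i,0..n+i})
-- to row i-1 (μ^{i-1,0..n+i-1}), computed right to left:
-- μ^{i-1,n+i-1} = λ^n, μ^{i-1,j-1} = sort(μ^{i-1,j} + μ^{i,j-1} - μ^{i,j}).
dualStep : {r : ℕ} → List (Vecℤ r) → List (Vecℤ r)
dualStep [] = []
dualStep (x ∷ []) = []
dualStep (x ∷ y ∷ rest) with dualStep (y ∷ rest)
... | [] = y ∷ []
... | h ∷ hs = sort ((h ⊕ x) ⊖ y) ∷ h ∷ hs

headD : {r : ℕ} → List (Vecℤ r) → Vecℤ r
headD [] = zeroV
headD (x ∷ _) = x

-- E*(T) = (μ^{0,0}, μ^{-1,0}, …, μ^{-n,0})
dualEvacGo : {r : ℕ} → ℕ → List (Vecℤ r) → List (Vecℤ r)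
dualEvacGo zero ν = headD ν ∷ []
dualEvacGo (suc k) ν = headD ν ∷ dualEvacGo k (dualStep ν)

dualEvacuation : {r : ℕ} → ℕ → List (Vecℤ r) → List (Vecℤ r)
dualEvacuation n T = dualEvacGo n T

{-# OPTIONS --safe #-}

-- Everything rests on the local rule d = sort (b + c − a) being an involution on squares of
-- steps: if b and c are obtained from a by steps e_S, then so is d from b and from c, and
-- sort (b + c − d) = a. Write A t, B t, … for the number of entries ≥ t. Counts do not see
-- sorting, and for unit steps (negative steps become unit steps after adding 1 to every entry)
-- the rule reads  D (t+1) + A t = max (B (t+1)) (C (t+1)) + min (B t) (C t),  where the max is
-- ≤ A t and the min is ≥ A t; this squeezes D between B and C, and the same identity for the
-- square d → b + 1, c + 1 gives back A.
-- A triangle filled by an involutive local rule is determined by either pair of its sides.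
-- Reading the promotion triangle of E T from the other side gives E (E T) = T; reflecting
-- the dual-evacuation triangle through λ ↦ rev (−λ) gives E (ε T) = ε (E* T); and the
-- promotion triangle of T, read along its diagonals, is the dual-evacuation triangle of
-- Pⁿ T, so E* (Pⁿ T) = E T. The theorem follows formally from these identities and ε² = id.
module Submission where

open import Defs
open import Data.Nat using (ℕ)
open import Data.List using (List)
open import Data.Product using (_×_)
open import Function.Bundles using (_⇔_)
open import Relation.Binary.PropositionalEquality using (_≡_)

module LocalRule where

  open import Data.Bool using (true; false; if_then_else_)
  open import Data.Empty using (⊥-elim)
  open import Data.Nat as ℕ using (zero; suc; z≤n; s≤s)
  import Data.Nat.Properties as ℕ
  open import Data.Integer as ℤ using (ℤ; _+_; _-_; -_; 0ℤ; 1ℤ; -1ℤ; _≤_; _≥_; _<_; _≤?_; _⊔_; _⊓_)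
  import Data.Integer.Properties as ℤ
  open import Data.Integer.Tactic.RingSolver using (solve-∀)
  open import Data.Fin.Subset using (Subset)
  open import Data.Vec as Vec using (Vec; []; _∷_; map; zipWith; reverse; _∷ʳ_)
  import Data.Vec.Properties as Vec
  open import Data.Vec.Relation.Unary.All as All using (All; []; _∷_)
  open import Data.Vec.Relation.Unary.AllPairs as AllPairs using (AllPairs; []; _∷_)
  import Data.Vec.Relation.Unary.AllPairs.Properties as AllPairs
  import Data.Vec.Relation.Unary.All.Properties as All
  import Data.Fin as Fin
  open import Data.Vec.Relation.Binary.Pointwise.Inductive using (Pointwise; []; _∷_)
  open import Data.Product as Product using (Σ; _,_; proj₁; proj₂)
  open import Data.Sum using (_⊎_; inj₁; inj₂)
  open import Function using (_∘_; flip)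
  open import Relation.Nullary using (¬_; does; yes; no; contradiction)
  open import Relation.Nullary.Decidable using (dec-true; dec-false)
  open import Relation.Binary.PropositionalEquality
  open import Algebra.Properties.CommutativeSemigroup ℕ.+-commutativeSemigroup
    using (interchange; x∙yz≈y∙xz)
  open import Algebra.Bundles using (AbelianGroup)
  open import Algebra.Properties.Group (AbelianGroup.group ℤ.+-0-abelianGroup)
    using () renaming (∙-cancelˡ to +-cancelˡ-≡)

  private variable
    m : ℕ
    t x y z : ℤ
    a b c u v w : Vec ℤ m

  +-cancelˡ-≤ : ∀ k → k + x ≤ k + y → x ≤ y
  +-cancelˡ-≤ {x} {y} k le = subst₂ _≤_ (cancel k x) (cancel k y) (ℤ.+-monoʳ-≤ (- k) le)
    where
    cancel : ∀ k z → - k + (k + z) ≡ z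
    cancel = solve-∀

  -- Counting entries ≥ t

  𝟙[_≤_] : ℤ → ℤ → ℕ
  𝟙[ t ≤ x ] = if does (t ≤? x) then 1 else 0

  𝟙-yes : t ≤ x → 𝟙[ t ≤ x ] ≡ 1
  𝟙-yes {t} {x} t≤x = cong (if_then 1 else 0) (dec-true (t ≤? x) t≤x)

  𝟙-no : ¬ t ≤ x → 𝟙[ t ≤ x ] ≡ 0
  𝟙-no {t} {x} t≰x = cong (if_then 1 else 0) (dec-false (t ≤? x) t≰x)

  𝟙≤1 : ∀ t x → 𝟙[ t ≤ x ] ℕ.≤ 1
  𝟙≤1 t x with t ≤? x
  ... | yes _ = s≤s z≤n
  ... | no _ = z≤n

  𝟙-mono : ∀ t → x ≤ y → 𝟙[ t ≤ x ] ℕ.≤ 𝟙[ t ≤ y ]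
  𝟙-mono {x} t x≤y with t ≤? x
  ... | yes t≤x = ℕ.≤-reflexive (sym (𝟙-yes (ℤ.≤-trans t≤x x≤y)))
  ... | no _ = z≤n

  𝟙-shift : ∀ k t x → 𝟙[ k + t ≤ k + x ] ≡ 𝟙[ t ≤ x ]
  𝟙-shift k t x with t ≤? x
  ... | yes t≤x = 𝟙-yes (ℤ.+-monoʳ-≤ k t≤x)
  ... | no t≰x = 𝟙-no (t≰x ∘ +-cancelˡ-≤ k)

  𝟙-⊔ : ∀ t x y → 𝟙[ t ≤ x ⊔ y ] ≡ 𝟙[ t ≤ x ] ℕ.⊔ 𝟙[ t ≤ y ]
  𝟙-⊔ t x y with ℤ.≤-total x y
  ... | inj₁ x≤y = trans (cong 𝟙[ t ≤_] (ℤ.i≤j⇒i⊔j≡j x≤y)) (sym (ℕ.m≤n⇒m⊔n≡n (𝟙-mono t x≤y)))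
  ... | inj₂ y≤x = trans (cong 𝟙[ t ≤_] (ℤ.i≥j⇒i⊔j≡i y≤x)) (sym (ℕ.m≥n⇒m⊔n≡m (𝟙-mono t y≤x)))

  𝟙-⊓ : ∀ t x y → 𝟙[ t ≤ x ⊓ y ] ≡ 𝟙[ t ≤ x ] ℕ.⊓ 𝟙[ t ≤ y ]
  𝟙-⊓ t x y with ℤ.≤-total x y
  ... | inj₁ x≤y = trans (cong 𝟙[ t ≤_] (ℤ.i≤j⇒i⊓j≡i x≤y)) (sym (ℕ.m≤n⇒m⊓n≡m (𝟙-mono t x≤y)))
  ... | inj₂ y≤x = trans (cong 𝟙[ t ≤_] (ℤ.i≥j⇒i⊓j≡j y≤x)) (sym (ℕ.m≥n⇒m⊓n≡n (𝟙-mono t y≤x)))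

  𝟙-neg : ∀ t x → 𝟙[ t ≤ - x ] ℕ.+ 𝟙[ ℤ.suc (- t) ≤ x ] ≡ 1
  𝟙-neg t x with t ≤? - x | ℤ.suc (- t) ≤? x
  ... | yes t≤-x | yes 1-t≤x = ⊥-elim (ℤ.<-irrefl refl (ℤ.suc[i]≤j⇒i<j (ℤ.≤-trans 1-t≤x x≤-t)))
    where
    x≤-t : x ≤ - t
    x≤-t = subst (_≤ - t) (ℤ.neg-involutive x) (ℤ.neg-mono-≤ t≤-x)
  ... | yes _ | no _ = refl
  ... | no _ | yes _ = refl
  ... | no t≰-x | no 1-t≰x = ⊥-elim (1-t≰x (ℤ.i<j⇒suc[i]≤j -t<x))
    where
    -t<x : - t < x
    -t<x = subst (- t <_) (ℤ.neg-involutive x) (ℤ.neg-mono-< (ℤ.≰⇒> t≰-x))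

  count≥ : Vec ℤ m → ℤ → ℕ
  count≥ [] t = 0
  count≥ (x ∷ xs) t = 𝟙[ t ≤ x ] ℕ.+ count≥ xs t

  Descending : Vec ℤ m → Set
  Descending = AllPairs _≥_

  isGenPartition⇒descending : (v : Vec ℤ m) → IsGenPartition v → Descending v
  isGenPartition⇒descending [] _ = []
  isGenPartition⇒descending (x ∷ v) v↓ =
    All.lookup⁻ (λ j → v↓ Fin.zero (Fin.suc j) z≤n) ∷
    isGenPartition⇒descending v (λ i j i≤j → v↓ (Fin.suc i) (Fin.suc j) (s≤s i≤j))

  insert-bounded : ∀ x (v : Vec ℤ m) → All (y ≥_) v → y ≥ x → All (y ≥_) (insertDesc x v)
  insert-bounded x [] [] y≥x = y≥x ∷ []
  insert-bounded x (z ∷ v) (y≥z ∷ y≥v) y≥x with z ≤? x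
  ... | yes _ = y≥x ∷ y≥z ∷ y≥v
  ... | no _ = y≥z ∷ insert-bounded x v y≥v y≥x

  insert-descending : ∀ x (v : Vec ℤ m) → Descending v → Descending (insertDesc x v)
  insert-descending x [] [] = [] ∷ []
  insert-descending x (z ∷ v) (z≥v ∷ dv) with z ≤? x
  ... | yes z≤x = (z≤x ∷ All.map (λ w≤z → ℤ.≤-trans w≤z z≤x) z≥v) ∷ z≥v ∷ dv
  ... | no z≰x = insert-bounded x v z≥v (ℤ.<⇒≤ (ℤ.≰⇒> z≰x)) ∷ insert-descending x v dv

  sort-descending : (v : Vec ℤ m) → Descending (sort v)
  sort-descending [] = []
  sort-descending (x ∷ v) = insert-descending x (sort v) (sort-descending v)

  count≥-insert : ∀ x (v : Vec ℤ m) t → count≥ (insertDesc x v) t ≡ 𝟙[ t ≤ x ] ℕ.+ count≥ v t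
  count≥-insert x [] t = refl
  count≥-insert x (z ∷ v) t with z ≤? x
  ... | yes _ = refl
  ... | no _ = begin
    𝟙[ t ≤ z ] ℕ.+ count≥ (insertDesc x v) t  ≡⟨ cong (𝟙[ t ≤ z ] ℕ.+_) (count≥-insert x v t) ⟩
    𝟙[ t ≤ z ] ℕ.+ (𝟙[ t ≤ x ] ℕ.+ count≥ v t) ≡⟨ x∙yz≈y∙xz 𝟙[ t ≤ z ] 𝟙[ t ≤ x ] (count≥ v t) ⟩
    𝟙[ t ≤ x ] ℕ.+ (𝟙[ t ≤ z ] ℕ.+ count≥ v t) ∎
    where open ≡-Reasoning

  count≥-sort : (v : Vec ℤ m) → ∀ t → count≥ (sort v) t ≡ count≥ v t
  count≥-sort [] t = refl
  count≥-sort (x ∷ v) t = trans (count≥-insert x (sort v) t) (cong (𝟙[ t ≤ x ] ℕ.+_) (count≥-sort v t))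

  count≥-bounded : All (y ≥_) v → y < t → count≥ v t ≡ 0
  count≥-bounded [] y<t = refl
  count≥-bounded (y≥z ∷ y≥v) y<t =
    cong₂ ℕ._+_ (𝟙-no (λ t≤z → ℤ.<⇒≱ y<t (ℤ.≤-trans t≤z y≥z))) (count≥-bounded y≥v y<t)

  count≥-mono : {u w : Vec ℤ m} → Pointwise _≤_ u w → ∀ t → count≥ u t ℕ.≤ count≥ w t
  count≥-mono [] t = z≤n
  count≥-mono (x≤y ∷ u≤w) t = ℕ.+-mono-≤ (𝟙-mono t x≤y) (count≥-mono u≤w t)

  count≥-reflects-≤ : {u w : Vec ℤ m} → Descending u → Descending w →
    (∀ t → count≥ u t ℕ.≤ count≥ w t) → Pointwise _≤_ u w
  count≥-reflects-≤ {u = []} {[]} [] [] _ = []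
  count≥-reflects-≤ {u = x ∷ u} {y ∷ w} (x≥u ∷ du) (y≥w ∷ dw) u≤w = x≤y ∷ count≥-reflects-≤ du dw tail≤
    where
    x≤y : x ≤ y
    x≤y with x ≤? y
    ... | yes x≤y = x≤y
    ... | no x≰y = ⊥-elim (ℕ.n≮0 (subst₂ ℕ._≤_ at-x at-y (u≤w x)))
      where
      at-x : 𝟙[ x ≤ x ] ℕ.+ count≥ u x ≡ suc (count≥ u x)
      at-x = cong (ℕ._+ count≥ u x) (𝟙-yes {x} ℤ.≤-refl)
      at-y : 𝟙[ x ≤ y ] ℕ.+ count≥ w x ≡ 0
      at-y = cong₂ ℕ._+_ (𝟙-no x≰y) (count≥-bounded y≥w (ℤ.≰⇒> x≰y))
    tail≤ : ∀ t → count≥ u t ℕ.≤ count≥ w t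
    tail≤ t with t ≤? x
    ... | no t≰x = subst (ℕ._≤ count≥ w t) (sym (count≥-bounded x≥u (ℤ.≰⇒> t≰x))) z≤n
    ... | yes t≤x = ℕ.+-cancelˡ-≤ 1 _ _
      (subst₂ ℕ._≤_ (cong (ℕ._+ count≥ u t) (𝟙-yes t≤x)) (cong (ℕ._+ count≥ w t) (𝟙-yes (ℤ.≤-trans t≤x x≤y)))
              (u≤w t))

  Pointwise-antisym : {u w : Vec ℤ m} → Pointwise _≤_ u w → Pointwise _≤_ w u → u ≡ w
  Pointwise-antisym [] [] = refl
  Pointwise-antisym (x≤y ∷ u≤w) (y≤x ∷ w≤u) = cong₂ _∷_ (ℤ.≤-antisym x≤y y≤x) (Pointwise-antisym u≤w w≤u)

  count≥-injective : {u w : Vec ℤ m} → Descending u → Descending w → (∀ t → count≥ u t ≡ count≥ w t) → u ≡ w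
  count≥-injective du dw u≡w = Pointwise-antisym
    (count≥-reflects-≤ du dw (ℕ.≤-reflexive ∘ u≡w))
    (count≥-reflects-≤ dw du (ℕ.≤-reflexive ∘ sym ∘ u≡w))

  shift : ℤ → Vec ℤ m → Vec ℤ m
  shift k = map (k +_)

  shift-comm : ∀ k l (v : Vec ℤ m) → shift k (shift l v) ≡ shift l (shift k v)
  shift-comm k l v = begin
    map (k +_) (map (l +_) v) ≡⟨ Vec.map-∘ (k +_) (l +_) v ⟨
    map (λ x → k + (l + x)) v ≡⟨ Vec.map-cong swap v ⟩
    map (λ x → l + (k + x)) v ≡⟨ Vec.map-∘ (l +_) (k +_) v ⟩
    map (l +_) (map (k +_) v) ∎
    where
    open ≡-Reasoning
    swap : ∀ x → k + (l + x) ≡ l + (k + x)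
    swap x = trans (sym (ℤ.+-assoc k l x)) (trans (cong (_+ x) (ℤ.+-comm k l)) (ℤ.+-assoc l k x))

  shift-descending : ∀ k → Descending v → Descending (shift k v)
  shift-descending k dv = AllPairs.map⁺ (AllPairs.map (ℤ.+-monoʳ-≤ k) dv)

  count≥-shift : ∀ k (v : Vec ℤ m) t → count≥ (shift k v) (k + t) ≡ count≥ v t
  count≥-shift k [] t = refl
  count≥-shift k (x ∷ v) t = cong₂ ℕ._+_ (𝟙-shift k t x) (count≥-shift k v t)

  ∀-shifted : ∀ k {P : ℤ → Set} → (∀ t → P (k + t)) → ∀ t → P t
  ∀-shifted k {P} P[k+_] t = subst P (k+[-k+t]≡t k t) (P[k+ (- k + t) ])
    where
    k+[-k+t]≡t : ∀ k t → k + (- k + t) ≡ t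
    k+[-k+t]≡t = solve-∀

  sort-shift : ∀ k (v : Vec ℤ m) → sort (shift k v) ≡ shift k (sort v)
  sort-shift k v =
    count≥-injective (sort-descending (shift k v)) (shift-descending k (sort-descending v)) (∀-shifted k λ t →
      begin
        count≥ (sort (shift k v)) (k + t) ≡⟨ count≥-sort (shift k v) (k + t) ⟩
        count≥ (shift k v) (k + t)        ≡⟨ count≥-shift k v t ⟩
        count≥ v t                        ≡⟨ count≥-sort v t ⟨
        count≥ (sort v) t                 ≡⟨ count≥-shift k (sort v) t ⟨
        count≥ (shift k (sort v)) (k + t) ∎)
    where open ≡-Reasoning

  -- Unit steps and the local rule

  UnitStep : Vec ℤ m → Vec ℤ m → Set
  UnitStep = Pointwise (λ x y → y ≡ x ⊎ y ≡ ℤ.suc x)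

  unitStep-lower : UnitStep a b → Pointwise _≤_ a b
  unitStep-lower [] = []
  unitStep-lower (inj₁ refl ∷ a→b) = ℤ.≤-refl ∷ unitStep-lower a→b
  unitStep-lower (inj₂ refl ∷ a→b) = ℤ.i≤suc[i] _ ∷ unitStep-lower a→b

  unitStep-upper : UnitStep a b → Pointwise _≤_ b (shift 1ℤ a)
  unitStep-upper [] = []
  unitStep-upper (inj₁ refl ∷ a→b) = ℤ.i≤suc[i] _ ∷ unitStep-upper a→b
  unitStep-upper (inj₂ refl ∷ a→b) = ℤ.≤-refl ∷ unitStep-upper a→b

  unitStep-between : {a b : Vec ℤ m} → Pointwise _≤_ a b → Pointwise _≤_ b (shift 1ℤ a) → UnitStep a b
  unitStep-between [] [] = []
  unitStep-between {a = x ∷ _} {y ∷ _} (x≤y ∷ a≤b) (y≤1+x ∷ b≤a+1) = between ∷ unitStep-between a≤b b≤a+1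
    where
    between : y ≡ x ⊎ y ≡ ℤ.suc x
    between with y ≤? x
    ... | yes y≤x = inj₁ (ℤ.≤-antisym y≤x x≤y)
    ... | no y≰x = inj₂ (ℤ.≤-antisym y≤1+x (ℤ.i<j⇒suc[i]≤j (ℤ.≰⇒> y≰x)))

  unitStep-next : UnitStep a b → UnitStep b (shift 1ℤ a)
  unitStep-next [] = []
  unitStep-next (inj₁ refl ∷ a→b) = inj₂ refl ∷ unitStep-next a→b
  unitStep-next (inj₂ refl ∷ a→b) = inj₁ refl ∷ unitStep-next a→b

  unitStep-unshift : ∀ k {u w : Vec ℤ m} → UnitStep (shift k u) (shift k w) → UnitStep u w
  unitStep-unshift k {u = []} {[]} [] = []
  unitStep-unshift k {u = x ∷ _} {y ∷ _} (step ∷ steps) = unshift step ∷ unitStep-unshift k steps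
    where
    cancel : ∀ {x y} → k + x ≡ k + y → x ≡ y
    cancel = +-cancelˡ-≡ k _ _
    unshift : k + y ≡ k + x ⊎ k + y ≡ ℤ.suc (k + x) → y ≡ x ⊎ y ≡ ℤ.suc x
    unshift (inj₁ eq) = inj₁ (cancel eq)
    unshift (inj₂ eq) = inj₂ (cancel (trans eq (k-comm k x)))
      where
      k-comm : ∀ k x → 1ℤ + (k + x) ≡ k + (1ℤ + x)
      k-comm = solve-∀

  Interlaced : Vec ℤ m → Vec ℤ m → Set
  Interlaced a b = (∀ t → count≥ a t ℕ.≤ count≥ b t) × (∀ t → count≥ b (ℤ.suc t) ℕ.≤ count≥ a t)

  unitStep⇒interlaced : UnitStep a b → Interlaced a b
  unitStep⇒interlaced {a = a} {b} a→b =
    count≥-mono (unitStep-lower a→b) ,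
    λ t → subst (count≥ b (ℤ.suc t) ℕ.≤_) (count≥-shift 1ℤ a t) (count≥-mono (unitStep-upper a→b) (ℤ.suc t))

  interlaced⇒unitStep : Descending a → Descending b → Interlaced a b → UnitStep a b
  interlaced⇒unitStep {a = a} {b} da db (a≤b , b≤a⁺) = unitStep-between
    (count≥-reflects-≤ da db a≤b)
    (count≥-reflects-≤ db (shift-descending 1ℤ da) (∀-shifted 1ℤ λ t →
      subst (count≥ b (ℤ.suc t) ℕ.≤_) (sym (count≥-shift 1ℤ a t)) (b≤a⁺ t)))

  𝟙≡0⇒> : 𝟙[ t ≤ x ] ≡ 0 → x < t
  𝟙≡0⇒> {t} {x} eq with t ≤? x
  ... | yes _ = contradiction eq λ ()
  ... | no t≰x = ℤ.≰⇒> t≰x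

  -- i and j are head indicators and X, Y the tail counts, which vanish with the indicator.
  ⊔-indicators : ∀ i j X Y → i ℕ.≤ 1 → j ℕ.≤ 1 → (i ≡ 0 → X ≡ 0) → (j ≡ 0 → Y ≡ 0) →
    (i ℕ.⊔ j) ℕ.+ (X ℕ.⊔ Y) ≡ (i ℕ.+ X) ℕ.⊔ (j ℕ.+ Y)
  ⊔-indicators 0 0 X Y _ _ X≡0 Y≡0 rewrite X≡0 refl | Y≡0 refl = refl
  ⊔-indicators 0 1 X Y _ _ X≡0 _ rewrite X≡0 refl = refl
  ⊔-indicators 1 0 X Y _ _ _ Y≡0 rewrite Y≡0 refl = cong suc (ℕ.⊔-identityʳ X)
  ⊔-indicators 1 1 X Y _ _ _ _ = refl
  ⊔-indicators (suc (suc _)) _ _ _ (s≤s ()) _ _ _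
  ⊔-indicators _ (suc (suc _)) _ _ _ (s≤s ()) _ _

  ⊓-indicators : ∀ i j X Y → i ℕ.≤ 1 → j ℕ.≤ 1 → (i ≡ 0 → X ≡ 0) → (j ≡ 0 → Y ≡ 0) →
    (i ℕ.⊓ j) ℕ.+ (X ℕ.⊓ Y) ≡ (i ℕ.+ X) ℕ.⊓ (j ℕ.+ Y)
  ⊓-indicators 0 0 X Y _ _ X≡0 _ rewrite X≡0 refl = refl
  ⊓-indicators 0 1 X Y _ _ X≡0 _ rewrite X≡0 refl = refl
  ⊓-indicators 1 0 X Y _ _ _ Y≡0 rewrite Y≡0 refl = trans (ℕ.⊓-zeroʳ X) (sym (ℕ.⊓-zeroʳ (suc X)))
  ⊓-indicators 1 1 X Y _ _ _ _ = refl
  ⊓-indicators (suc (suc _)) _ _ _ (s≤s ()) _ _ _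
  ⊓-indicators _ (suc (suc _)) _ _ _ (s≤s ()) _ _

  count≥-zipWith-⊔ : {b c : Vec ℤ m} → Descending b → Descending c → ∀ t →
    count≥ (zipWith _⊔_ b c) t ≡ count≥ b t ℕ.⊔ count≥ c t
  count≥-zipWith-⊔ {b = []} {[]} [] [] t = refl
  count≥-zipWith-⊔ {b = y ∷ b} {z ∷ c} (y≥b ∷ db) (z≥c ∷ dc) t = begin
    𝟙[ t ≤ y ⊔ z ] ℕ.+ count≥ (zipWith _⊔_ b c) t
      ≡⟨ cong₂ ℕ._+_ (𝟙-⊔ t y z) (count≥-zipWith-⊔ db dc t) ⟩
    (𝟙[ t ≤ y ] ℕ.⊔ 𝟙[ t ≤ z ]) ℕ.+ (count≥ b t ℕ.⊔ count≥ c t)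
      ≡⟨ ⊔-indicators _ _ _ _ (𝟙≤1 t y) (𝟙≤1 t z)
           (count≥-bounded y≥b ∘ 𝟙≡0⇒>) (count≥-bounded z≥c ∘ 𝟙≡0⇒>) ⟩
    (𝟙[ t ≤ y ] ℕ.+ count≥ b t) ℕ.⊔ (𝟙[ t ≤ z ] ℕ.+ count≥ c t) ∎
    where open ≡-Reasoning

  count≥-zipWith-⊓ : {b c : Vec ℤ m} → Descending b → Descending c → ∀ t →
    count≥ (zipWith _⊓_ b c) t ≡ count≥ b t ℕ.⊓ count≥ c t
  count≥-zipWith-⊓ {b = []} {[]} [] [] t = refl
  count≥-zipWith-⊓ {b = y ∷ b} {z ∷ c} (y≥b ∷ db) (z≥c ∷ dc) t = begin
    𝟙[ t ≤ y ⊓ z ] ℕ.+ count≥ (zipWith _⊓_ b c) t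
      ≡⟨ cong₂ ℕ._+_ (𝟙-⊓ t y z) (count≥-zipWith-⊓ db dc t) ⟩
    (𝟙[ t ≤ y ] ℕ.⊓ 𝟙[ t ≤ z ]) ℕ.+ (count≥ b t ℕ.⊓ count≥ c t)
      ≡⟨ ⊓-indicators _ _ _ _ (𝟙≤1 t y) (𝟙≤1 t z)
           (count≥-bounded y≥b ∘ 𝟙≡0⇒>) (count≥-bounded z≥c ∘ 𝟙≡0⇒>) ⟩
    (𝟙[ t ≤ y ] ℕ.+ count≥ b t) ℕ.⊓ (𝟙[ t ≤ z ] ℕ.+ count≥ c t) ∎
    where open ≡-Reasoning

  x+x-x≡x : ∀ x → (x + x) - x ≡ x
  x+x-x≡x = solve-∀

  x+1+x-x≡x+1 : ∀ x → ((1ℤ + x) + x) - x ≡ 1ℤ + x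
  x+1+x-x≡x+1 = solve-∀

  x+x+1-x≡x+1 : ∀ x → (x + (1ℤ + x)) - x ≡ 1ℤ + x
  x+x+1-x≡x+1 = solve-∀

  x+1+x+1-x≡x+2 : ∀ x → ((1ℤ + x) + (1ℤ + x)) - x ≡ 1ℤ + (1ℤ + x)
  x+1+x+1-x≡x+2 = solve-∀

  𝟙-localRule : (y ≡ x ⊎ y ≡ ℤ.suc x) → (z ≡ x ⊎ z ≡ ℤ.suc x) → ∀ w →
    𝟙[ ℤ.suc w ≤ (y + z) - x ] ℕ.+ 𝟙[ w ≤ x ] ≡ 𝟙[ ℤ.suc w ≤ y ⊔ z ] ℕ.+ 𝟙[ w ≤ y ⊓ z ]
  𝟙-localRule {x = x} (inj₁ refl) (inj₁ refl) w
    rewrite x+x-x≡x x | ℤ.⊔-idem x | ℤ.⊓-idem x = refl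
  𝟙-localRule {x = x} (inj₂ refl) (inj₁ refl) w
    rewrite x+1+x-x≡x+1 x | ℤ.i≥j⇒i⊔j≡i (ℤ.i≤suc[i] x) | ℤ.i≥j⇒i⊓j≡j (ℤ.i≤suc[i] x) = refl
  𝟙-localRule {x = x} (inj₁ refl) (inj₂ refl) w
    rewrite x+x+1-x≡x+1 x | ℤ.i≤j⇒i⊔j≡j (ℤ.i≤suc[i] x) | ℤ.i≤j⇒i⊓j≡i (ℤ.i≤suc[i] x) = refl
  𝟙-localRule {x = x} (inj₂ refl) (inj₂ refl) w
    rewrite x+1+x+1-x≡x+2 x | ℤ.⊔-idem (ℤ.suc x) | ℤ.⊓-idem (ℤ.suc x)
          | 𝟙-shift 1ℤ w (ℤ.suc x) | 𝟙-shift 1ℤ w x = ℕ.+-comm 𝟙[ w ≤ ℤ.suc x ] 𝟙[ w ≤ x ]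

  count≥-sum-⊔-⊓ : {a b c : Vec ℤ m} → UnitStep a b → UnitStep a c → ∀ w →
    count≥ ((b ⊕ c) ⊖ a) (ℤ.suc w) ℕ.+ count≥ a w
      ≡ count≥ (zipWith _⊔_ b c) (ℤ.suc w) ℕ.+ count≥ (zipWith _⊓_ b c) w
  count≥-sum-⊔-⊓ [] [] w = refl
  count≥-sum-⊔-⊓ {a = x ∷ a} {y ∷ b} {z ∷ c} (x→y ∷ a→b) (x→z ∷ a→c) w = begin
    (𝟙[ ℤ.suc w ≤ (y + z) - x ] ℕ.+ count≥ ((b ⊕ c) ⊖ a) (ℤ.suc w)) ℕ.+ (𝟙[ w ≤ x ] ℕ.+ count≥ a w)
      ≡⟨ interchange 𝟙[ ℤ.suc w ≤ (y + z) - x ] _ 𝟙[ w ≤ x ] _ ⟩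
    (𝟙[ ℤ.suc w ≤ (y + z) - x ] ℕ.+ 𝟙[ w ≤ x ]) ℕ.+ (count≥ ((b ⊕ c) ⊖ a) (ℤ.suc w) ℕ.+ count≥ a w)
      ≡⟨ cong₂ ℕ._+_ (𝟙-localRule x→y x→z w) (count≥-sum-⊔-⊓ a→b a→c w) ⟩
    (𝟙[ ℤ.suc w ≤ y ⊔ z ] ℕ.+ 𝟙[ w ≤ y ⊓ z ]) ℕ.+
      (count≥ (zipWith _⊔_ b c) (ℤ.suc w) ℕ.+ count≥ (zipWith _⊓_ b c) w)
      ≡⟨ interchange 𝟙[ ℤ.suc w ≤ y ⊔ z ] _ _ _ ⟩
    (𝟙[ ℤ.suc w ≤ y ⊔ z ] ℕ.+ count≥ (zipWith _⊔_ b c) (ℤ.suc w)) ℕ.+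
      (𝟙[ w ≤ y ⊓ z ] ℕ.+ count≥ (zipWith _⊓_ b c) w) ∎
    where open ≡-Reasoning

  localRule : Vec ℤ m → Vec ℤ m → Vec ℤ m → Vec ℤ m
  localRule a b c = sort ((b ⊕ c) ⊖ a)

  count≥-localRule : Descending b → Descending c → UnitStep a b → UnitStep a c → ∀ w →
    count≥ (localRule a b c) (ℤ.suc w) ℕ.+ count≥ a w
      ≡ (count≥ b (ℤ.suc w) ℕ.⊔ count≥ c (ℤ.suc w)) ℕ.+ (count≥ b w ℕ.⊓ count≥ c w)
  count≥-localRule {b = b} {c = c} {a = a} db dc a→b a→c w = begin
    count≥ (localRule a b c) (ℤ.suc w) ℕ.+ count≥ a w
      ≡⟨ cong (ℕ._+ count≥ a w) (count≥-sort ((b ⊕ c) ⊖ a) (ℤ.suc w)) ⟩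
    count≥ ((b ⊕ c) ⊖ a) (ℤ.suc w) ℕ.+ count≥ a w
      ≡⟨ count≥-sum-⊔-⊓ a→b a→c w ⟩
    count≥ (zipWith _⊔_ b c) (ℤ.suc w) ℕ.+ count≥ (zipWith _⊓_ b c) w
      ≡⟨ cong₂ ℕ._+_ (count≥-zipWith-⊔ db dc (ℤ.suc w)) (count≥-zipWith-⊓ db dc w) ⟩
    (count≥ b (ℤ.suc w) ℕ.⊔ count≥ c (ℤ.suc w)) ℕ.+ (count≥ b w ℕ.⊓ count≥ c w) ∎
    where open ≡-Reasoning

  squeeze : ∀ {M a μ d} → M ℕ.≤ a → a ℕ.≤ μ → d ℕ.+ a ≡ M ℕ.+ μ → M ℕ.≤ d × d ℕ.≤ μ
  squeeze {M} {a} {μ} {d} M≤a a≤μ eq =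
    ℕ.+-cancelʳ-≤ a M d (subst (M ℕ.+ a ℕ.≤_) (sym eq) (ℕ.+-monoʳ-≤ M a≤μ)) ,
    ℕ.+-cancelʳ-≤ a d μ (subst (ℕ._≤ μ ℕ.+ a) (sym eq)
      (subst (M ℕ.+ μ ℕ.≤_) (ℕ.+-comm a μ) (ℕ.+-monoˡ-≤ μ M≤a)))

  [k+y+[l+z]]-x≡k+[l+[y+z-x]] : ∀ k l x y z → ((k + y) + (l + z)) - x ≡ k + (l + ((y + z) - x))
  [k+y+[l+z]]-x≡k+[l+[y+z-x]] = solve-∀

  [k+y+[l+z]]-[k+[l+x]]≡y+z-x : ∀ k l x y z → ((k + y) + (l + z)) - (k + (l + x)) ≡ (y + z) - x
  [k+y+[l+z]]-[k+[l+x]]≡y+z-x = solve-∀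

  shift-⊕-⊖ : ∀ k l (a b c : Vec ℤ m) → (shift k b ⊕ shift l c) ⊖ a ≡ shift k (shift l ((b ⊕ c) ⊖ a))
  shift-⊕-⊖ k l [] [] [] = refl
  shift-⊕-⊖ k l (x ∷ a) (y ∷ b) (z ∷ c) =
    cong₂ _∷_ ([k+y+[l+z]]-x≡k+[l+[y+z-x]] k l x y z) (shift-⊕-⊖ k l a b c)

  shift-⊕-⊖-shift : ∀ k l (d b c : Vec ℤ m) → (shift k b ⊕ shift l c) ⊖ shift k (shift l d) ≡ (b ⊕ c) ⊖ d
  shift-⊕-⊖-shift k l [] [] [] = refl
  shift-⊕-⊖-shift k l (x ∷ d) (y ∷ b) (z ∷ c) =
    cong₂ _∷_ ([k+y+[l+z]]-[k+[l+x]]≡y+z-x k l x y z) (shift-⊕-⊖-shift k l d b c)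

  localRule-shift : ∀ k l (a b c : Vec ℤ m) →
    localRule a (shift k b) (shift l c) ≡ shift k (shift l (localRule a b c))
  localRule-shift k l a b c = begin
    sort ((shift k b ⊕ shift l c) ⊖ a)          ≡⟨ cong sort (shift-⊕-⊖ k l a b c) ⟩
    sort (shift k (shift l ((b ⊕ c) ⊖ a)))      ≡⟨ sort-shift k (shift l ((b ⊕ c) ⊖ a)) ⟩
    shift k (sort (shift l ((b ⊕ c) ⊖ a)))      ≡⟨ cong (shift k) (sort-shift l ((b ⊕ c) ⊖ a)) ⟩
    shift k (shift l (sort ((b ⊕ c) ⊖ a)))      ∎
    where open ≡-Reasoning

  localRule-shift-all : ∀ k l (d b c : Vec ℤ m) →
    localRule (shift k (shift l d)) (shift k b) (shift l c) ≡ localRule d b c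
  localRule-shift-all k l d b c = cong sort (shift-⊕-⊖-shift k l d b c)

  localRule-unitSteps : Descending a → Descending b → Descending c → UnitStep a b → UnitStep a c →
    UnitStep b (localRule a b c) × UnitStep c (localRule a b c)
  localRule-unitSteps {a = a} {b = b} {c = c} da db dc a→b a→c =
    interlaced⇒unitStep db dd
      (∀-shifted 1ℤ (λ w → ℕ.≤-trans (ℕ.m≤m⊔n _ _) (proj₁ (bounds w))) , λ w → ℕ.≤-trans (proj₂ (bounds w)) (ℕ.m⊓n≤m _ _)) ,
    interlaced⇒unitStep dc dd
      (∀-shifted 1ℤ (λ w → ℕ.≤-trans (ℕ.m≤n⊔m _ _) (proj₁ (bounds w))) , λ w → ℕ.≤-trans (proj₂ (bounds w)) (ℕ.m⊓n≤n _ _))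
    where
    dd : Descending (localRule a b c)
    dd = sort-descending ((b ⊕ c) ⊖ a)
    B C D : ℤ → ℕ
    B = count≥ b
    C = count≥ c
    D = count≥ (localRule a b c)
    bounds : ∀ w → B (ℤ.suc w) ℕ.⊔ C (ℤ.suc w) ℕ.≤ D (ℤ.suc w) × D (ℤ.suc w) ℕ.≤ B w ℕ.⊓ C w
    bounds w = squeeze
      (ℕ.⊔-lub (proj₂ (unitStep⇒interlaced a→b) w) (proj₂ (unitStep⇒interlaced a→c) w))
      (ℕ.⊓-glb (proj₁ (unitStep⇒interlaced a→b) w) (proj₁ (unitStep⇒interlaced a→c) w))
      (count≥-localRule db dc a→b a→c w)

  -- count≥-localRule for the square d → b + 1, c + 1, which is completed by localRule d b c + 2.
  count≥-localRule-back : {b c d : Vec ℤ m} → Descending b → Descending c → UnitStep b d → UnitStep c d → ∀ w →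
    count≥ (localRule d b c) w ℕ.+ count≥ d (ℤ.suc w)
      ≡ (count≥ b (ℤ.suc w) ℕ.⊔ count≥ c (ℤ.suc w)) ℕ.+ (count≥ b w ℕ.⊓ count≥ c w)
  count≥-localRule-back {b = b} {c = c} {d = d} db dc b→d c→d w = begin
    count≥ (localRule d b c) w ℕ.+ count≥ d (ℤ.suc w)
      ≡⟨ cong (ℕ._+ count≥ d (ℤ.suc w)) (trans (sym (count≥-shift 1ℤ (localRule d b c) w))
                                                (sym (count≥-shift 1ℤ (shift 1ℤ (localRule d b c)) (ℤ.suc w)))) ⟩
    count≥ (shift 1ℤ (shift 1ℤ (localRule d b c))) (ℤ.suc (ℤ.suc w)) ℕ.+ count≥ d (ℤ.suc w)
      ≡⟨ cong (λ v → count≥ v (ℤ.suc (ℤ.suc w)) ℕ.+ count≥ d (ℤ.suc w)) (localRule-shift 1ℤ 1ℤ d b c) ⟨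
    count≥ (localRule d (shift 1ℤ b) (shift 1ℤ c)) (ℤ.suc (ℤ.suc w)) ℕ.+ count≥ d (ℤ.suc w)
      ≡⟨ count≥-localRule (shift-descending 1ℤ db) (shift-descending 1ℤ dc)
           (unitStep-next b→d) (unitStep-next c→d) (ℤ.suc w) ⟩
    (count≥ (shift 1ℤ b) (ℤ.suc (ℤ.suc w)) ℕ.⊔ count≥ (shift 1ℤ c) (ℤ.suc (ℤ.suc w))) ℕ.+
      (count≥ (shift 1ℤ b) (ℤ.suc w) ℕ.⊓ count≥ (shift 1ℤ c) (ℤ.suc w))
      ≡⟨ cong₂ ℕ._+_ (cong₂ ℕ._⊔_ (count≥-shift 1ℤ b (ℤ.suc w)) (count≥-shift 1ℤ c (ℤ.suc w)))
                     (cong₂ ℕ._⊓_ (count≥-shift 1ℤ b w) (count≥-shift 1ℤ c w)) ⟩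
    (count≥ b (ℤ.suc w) ℕ.⊔ count≥ c (ℤ.suc w)) ℕ.+ (count≥ b w ℕ.⊓ count≥ c w) ∎
    where open ≡-Reasoning

  localRule-involutive-unit : Descending a → Descending b → Descending c → UnitStep a b → UnitStep a c →
    localRule (localRule a b c) b c ≡ a
  localRule-involutive-unit {a = a} {b = b} {c = c} da db dc a→b a→c =
    count≥-injective (sort-descending ((b ⊕ c) ⊖ d)) da λ w →
      ℕ.+-cancelʳ-≡ (count≥ d (ℤ.suc w)) _ _ (begin
        count≥ (localRule d b c) w ℕ.+ count≥ d (ℤ.suc w) ≡⟨ count≥-localRule-back db dc b→d c→d w ⟩
        _                                                 ≡⟨ count≥-localRule db dc a→b a→c w ⟨
        count≥ d (ℤ.suc w) ℕ.+ count≥ a w                 ≡⟨ ℕ.+-comm _ (count≥ a w) ⟩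
        count≥ a w ℕ.+ count≥ d (ℤ.suc w)                 ∎)
    where
    open ≡-Reasoning
    d : Vec ℤ _
    d = localRule a b c
    b→d : UnitStep b d
    b→d = proj₁ (localRule-unitSteps da db dc a→b a→c)
    c→d : UnitStep c d
    c→d = proj₂ (localRule-unitSteps da db dc a→b a→c)

  -- Signed steps

  Step : Vec ℤ m → Vec ℤ m → Set
  Step {m} a b = Σ Sign λ σ → Σ (Subset m) λ S → b ≡ a ⊕ e σ S

  -- Raising the target of a negative step by one turns it into a unit step.
  offset : Sign → ℤ
  offset pos = 0ℤ
  offset neg = 1ℤ

  0+[x+1]≡1+x : ∀ x → 0ℤ + (x + 1ℤ) ≡ 1ℤ + x
  0+[x+1]≡1+x = solve-∀

  0+[x+0]≡x : ∀ x → 0ℤ + (x + 0ℤ) ≡ x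
  0+[x+0]≡x = solve-∀

  1+[x-1]≡x : ∀ x → 1ℤ + (x + -1ℤ) ≡ x
  1+[x-1]≡x = solve-∀

  1+[x+0]≡1+x : ∀ x → 1ℤ + (x + 0ℤ) ≡ 1ℤ + x
  1+[x+0]≡1+x = solve-∀

  signedStep⇒unitStep : ∀ σ (a : Vec ℤ m) S → UnitStep a (shift (offset σ) (a ⊕ e σ S))
  signedStep⇒unitStep pos [] [] = []
  signedStep⇒unitStep neg [] [] = []
  signedStep⇒unitStep pos (x ∷ a) (true ∷ S) = inj₂ (0+[x+1]≡1+x x) ∷ signedStep⇒unitStep pos a S
  signedStep⇒unitStep pos (x ∷ a) (false ∷ S) = inj₁ (0+[x+0]≡x x) ∷ signedStep⇒unitStep pos a S
  signedStep⇒unitStep neg (x ∷ a) (true ∷ S) = inj₁ (1+[x-1]≡x x) ∷ signedStep⇒unitStep neg a S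
  signedStep⇒unitStep neg (x ∷ a) (false ∷ S) = inj₂ (1+[x+0]≡1+x x) ∷ signedStep⇒unitStep neg a S

  +-cancelˡ-≡′ : ∀ k → k + x ≡ z → k + y ≡ z → x ≡ y
  +-cancelˡ-≡′ k k+x≡z k+y≡z = +-cancelˡ-≡ k _ _ (trans k+x≡z (sym k+y≡z))

  unitStep⇒signedStep : ∀ σ {a b : Vec ℤ m} → UnitStep a (shift (offset σ) b) →
    Σ (Subset m) λ S → b ≡ a ⊕ e σ S
  unitStep⇒signedStep pos {[]} {[]} [] = [] , refl
  unitStep⇒signedStep neg {[]} {[]} [] = [] , refl
  unitStep⇒signedStep pos {x ∷ _} {_ ∷ _} (inj₁ eq ∷ a→b) =
    Product.map (false ∷_) (cong₂ _∷_ (+-cancelˡ-≡′ 0ℤ eq (0+[x+0]≡x x))) (unitStep⇒signedStep pos a→b)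
  unitStep⇒signedStep pos {x ∷ _} {_ ∷ _} (inj₂ eq ∷ a→b) =
    Product.map (true ∷_) (cong₂ _∷_ (+-cancelˡ-≡′ 0ℤ eq (0+[x+1]≡1+x x))) (unitStep⇒signedStep pos a→b)
  unitStep⇒signedStep neg {x ∷ _} {_ ∷ _} (inj₁ eq ∷ a→b) =
    Product.map (true ∷_) (cong₂ _∷_ (+-cancelˡ-≡′ 1ℤ eq (1+[x-1]≡x x))) (unitStep⇒signedStep neg a→b)
  unitStep⇒signedStep neg {x ∷ _} {_ ∷ _} (inj₂ eq ∷ a→b) =
    Product.map (false ∷_) (cong₂ _∷_ (+-cancelˡ-≡′ 1ℤ eq (1+[x+0]≡1+x x))) (unitStep⇒signedStep neg a→b)

  opposite : Sign → Sign
  opposite pos = neg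
  opposite neg = pos

  x≡[x+1]-1 : ∀ x → x ≡ (x + 1ℤ) + -1ℤ
  x≡[x+1]-1 = solve-∀

  x≡[x-1]+1 : ∀ x → x ≡ (x + -1ℤ) + 1ℤ
  x≡[x-1]+1 = solve-∀

  x≡[x+0]+0 : ∀ x → x ≡ (x + 0ℤ) + 0ℤ
  x≡[x+0]+0 = solve-∀

  step-back : ∀ σ (a : Vec ℤ m) S → a ≡ (a ⊕ e σ S) ⊕ e (opposite σ) S
  step-back pos [] [] = refl
  step-back neg [] [] = refl
  step-back pos (x ∷ a) (true ∷ S) = cong₂ _∷_ (x≡[x+1]-1 x) (step-back pos a S)
  step-back pos (x ∷ a) (false ∷ S) = cong₂ _∷_ (x≡[x+0]+0 x) (step-back pos a S)
  step-back neg (x ∷ a) (true ∷ S) = cong₂ _∷_ (x≡[x-1]+1 x) (step-back neg a S)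
  step-back neg (x ∷ a) (false ∷ S) = cong₂ _∷_ (x≡[x+0]+0 x) (step-back neg a S)

  step-sym : Step a b → Step b a
  step-sym {a = a} (σ , S , refl) = opposite σ , S , step-back σ a S

  localRule-square : Descending a → Descending b → Descending c → Step a b → Step a c →
    let d = localRule a b c in Step b d × Step c d × localRule d b c ≡ a
  localRule-square {a = a} {b = b} {c = c} da db dc (σ , S , b≡a+S) (τ , U , c≡a+U) =
    (τ , b→d) , (σ , c→d) , involutive
    where
    k l : ℤ
    k = offset σ
    l = offset τ
    d : Vec ℤ _
    d = localRule a b c
    a→b′ : UnitStep a (shift k b)
    a→b′ = subst (UnitStep a ∘ shift k) (sym b≡a+S) (signedStep⇒unitStep σ a S)
    a→c′ : UnitStep a (shift l c)
    a→c′ = subst (UnitStep a ∘ shift l) (sym c≡a+U) (signedStep⇒unitStep τ a U)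
    db′ : Descending (shift k b)
    db′ = shift-descending k db
    dc′ : Descending (shift l c)
    dc′ = shift-descending l dc
    d′ : Vec ℤ _
    d′ = localRule a (shift k b) (shift l c)
    unitSteps : UnitStep (shift k b) d′ × UnitStep (shift l c) d′
    unitSteps = localRule-unitSteps da db′ dc′ a→b′ a→c′
    shifted : d′ ≡ shift k (shift l d)
    shifted = localRule-shift k l a b c
    b→d : Σ (Subset _) λ S′ → d ≡ b ⊕ e τ S′
    b→d = unitStep⇒signedStep τ (unitStep-unshift k (subst (UnitStep (shift k b)) shifted (proj₁ unitSteps)))
    c→d : Σ (Subset _) λ U′ → d ≡ c ⊕ e σ U′
    c→d = unitStep⇒signedStep σ (unitStep-unshift l
      (subst (UnitStep (shift l c)) (trans shifted (shift-comm k l d)) (proj₂ unitSteps)))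
    involutive : localRule d b c ≡ a
    involutive = begin
      localRule d b c                                        ≡⟨ localRule-shift-all k l d b c ⟨
      localRule (shift k (shift l d)) (shift k b) (shift l c) ≡⟨ cong (λ v → localRule v (shift k b) (shift l c)) shifted ⟨
      localRule (localRule a (shift k b) (shift l c)) (shift k b) (shift l c) ≡⟨ localRule-involutive-unit da db′ dc′ a→b′ a→c′ ⟩
      a                                                      ∎
      where open ≡-Reasoning

  -- The symmetry λ ↦ rev (−λ)

  All-∷ʳ : ∀ {A : Set} {P : A → Set} {n x} {xs : Vec A n} → All P xs → P x → All P (xs ∷ʳ x)
  All-∷ʳ [] px = px ∷ []
  All-∷ʳ (py ∷ pxs) px = py ∷ All-∷ʳ pxs px

  All-reverse : ∀ {A : Set} {P : A → Set} {n} {xs : Vec A n} → All P xs → All P (reverse xs)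
  All-reverse [] = []
  All-reverse {P = P} {xs = x ∷ xs} (px ∷ pxs) =
    subst (All P) (sym (Vec.reverse-∷ x xs)) (All-∷ʳ (All-reverse pxs) px)

  AllPairs-∷ʳ : ∀ {A : Set} {R : A → A → Set} {n x} {xs : Vec A n} →
    AllPairs R xs → All (λ y → R y x) xs → AllPairs R (xs ∷ʳ x)
  AllPairs-∷ʳ [] [] = [] ∷ []
  AllPairs-∷ʳ (Ryxs ∷ Rxs) (Ryx ∷ Rxsx) = All-∷ʳ Ryxs Ryx ∷ AllPairs-∷ʳ Rxs Rxsx

  AllPairs-reverse : ∀ {A : Set} {R : A → A → Set} {n} {xs : Vec A n} →
    AllPairs R xs → AllPairs (flip R) (reverse xs)
  AllPairs-reverse [] = []
  AllPairs-reverse {R = R} {xs = x ∷ xs} (Rxxs ∷ Rxs) =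
    subst (AllPairs (flip R)) (sym (Vec.reverse-∷ x xs)) (AllPairs-∷ʳ (AllPairs-reverse Rxs) (All-reverse Rxxs))

  zipWith-∷ʳ : ∀ {A : Set} (f : A → A → A) {n} (xs ys : Vec A n) x y →
    zipWith f (xs ∷ʳ x) (ys ∷ʳ y) ≡ zipWith f xs ys ∷ʳ f x y
  zipWith-∷ʳ f [] [] x y = refl
  zipWith-∷ʳ f (u ∷ xs) (v ∷ ys) x y = cong (f u v ∷_) (zipWith-∷ʳ f xs ys x y)

  reverse-zipWith : ∀ {A : Set} (f : A → A → A) {n} (xs ys : Vec A n) →
    reverse (zipWith f xs ys) ≡ zipWith f (reverse xs) (reverse ys)
  reverse-zipWith f [] [] = refl
  reverse-zipWith f (x ∷ xs) (y ∷ ys) = begin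
    reverse (f x y ∷ zipWith f xs ys)                ≡⟨ Vec.reverse-∷ (f x y) (zipWith f xs ys) ⟩
    reverse (zipWith f xs ys) ∷ʳ f x y               ≡⟨ cong (_∷ʳ f x y) (reverse-zipWith f xs ys) ⟩
    zipWith f (reverse xs) (reverse ys) ∷ʳ f x y     ≡⟨ zipWith-∷ʳ f (reverse xs) (reverse ys) x y ⟨
    zipWith f (reverse xs ∷ʳ x) (reverse ys ∷ʳ y)    ≡⟨ cong₂ (zipWith f) (Vec.reverse-∷ x xs) (Vec.reverse-∷ y ys) ⟨
    zipWith f (reverse (x ∷ xs)) (reverse (y ∷ ys)) ∎
    where open ≡-Reasoning

  count≥-∷ʳ : ∀ (v : Vec ℤ m) x t → count≥ (v ∷ʳ x) t ≡ count≥ v t ℕ.+ 𝟙[ t ≤ x ]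
  count≥-∷ʳ [] x t = ℕ.+-comm 𝟙[ t ≤ x ] 0
  count≥-∷ʳ (y ∷ v) x t =
    trans (cong (𝟙[ t ≤ y ] ℕ.+_) (count≥-∷ʳ v x t)) (sym (ℕ.+-assoc 𝟙[ t ≤ y ] (count≥ v t) 𝟙[ t ≤ x ]))

  count≥-reverse : ∀ (v : Vec ℤ m) t → count≥ (reverse v) t ≡ count≥ v t
  count≥-reverse [] t = refl
  count≥-reverse (x ∷ v) t = begin
    count≥ (reverse (x ∷ v)) t          ≡⟨ cong (λ u → count≥ u t) (Vec.reverse-∷ x v) ⟩
    count≥ (reverse v ∷ʳ x) t           ≡⟨ count≥-∷ʳ (reverse v) x t ⟩
    count≥ (reverse v) t ℕ.+ 𝟙[ t ≤ x ] ≡⟨ cong (ℕ._+ 𝟙[ t ≤ x ]) (count≥-reverse v t) ⟩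
    count≥ v t ℕ.+ 𝟙[ t ≤ x ]           ≡⟨ ℕ.+-comm (count≥ v t) 𝟙[ t ≤ x ] ⟩
    𝟙[ t ≤ x ] ℕ.+ count≥ v t           ∎
    where open ≡-Reasoning

  count≥-neg : ∀ (v : Vec ℤ m) t → count≥ (neg' v) t ℕ.+ count≥ v (ℤ.suc (- t)) ≡ m
  count≥-neg [] t = refl
  count≥-neg (x ∷ v) t = trans
    (interchange 𝟙[ t ≤ - x ] (count≥ (neg' v) t) 𝟙[ ℤ.suc (- t) ≤ x ] (count≥ v (ℤ.suc (- t))))
    (cong₂ ℕ._+_ (𝟙-neg t x) (count≥-neg v t))

  negRev : Vec ℤ m → Vec ℤ m
  negRev v = rev (neg' v)

  negRev-involutive : (v : Vec ℤ m) → negRev (negRev v) ≡ v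
  negRev-involutive v = begin
    reverse (neg' (reverse (neg' v))) ≡⟨ cong reverse (Vec.map-reverse -_ (neg' v)) ⟩
    reverse (reverse (neg' (neg' v))) ≡⟨ Vec.reverse-involutive (neg' (neg' v)) ⟩
    neg' (neg' v)                     ≡⟨ Vec.map-∘ -_ -_ v ⟨
    map (λ x → - - x) v               ≡⟨ Vec.map-cong ℤ.neg-involutive v ⟩
    map (λ x → x) v                   ≡⟨ Vec.map-id v ⟩
    v                                 ∎
    where open ≡-Reasoning

  negRev-descending : Descending v → Descending (negRev v)
  negRev-descending dv = AllPairs-reverse (AllPairs.map⁺ (AllPairs.map ℤ.neg-mono-≤ dv))

  negRev-sort : (v : Vec ℤ m) → negRev (sort v) ≡ sort (negRev v)
  negRev-sort v = count≥-injective (negRev-descending (sort-descending v)) (sort-descending (negRev v)) λ t →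
    begin
      count≥ (negRev (sort v)) t ≡⟨ count≥-reverse (neg' (sort v)) t ⟩
      count≥ (neg' (sort v)) t   ≡⟨ ℕ.+-cancelʳ-≡ (count≥ v (ℤ.suc (- t))) _ _ (begin
          count≥ (neg' (sort v)) t ℕ.+ count≥ v (ℤ.suc (- t))
            ≡⟨ cong (count≥ (neg' (sort v)) t ℕ.+_) (count≥-sort v (ℤ.suc (- t))) ⟨
          count≥ (neg' (sort v)) t ℕ.+ count≥ (sort v) (ℤ.suc (- t))
            ≡⟨ count≥-neg (sort v) t ⟩
          _ ≡⟨ count≥-neg v t ⟨
          count≥ (neg' v) t ℕ.+ count≥ v (ℤ.suc (- t)) ∎) ⟩
      count≥ (neg' v) t          ≡⟨ count≥-reverse (neg' v) t ⟨
      count≥ (negRev v) t        ≡⟨ count≥-sort (negRev v) t ⟨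
      count≥ (sort (negRev v)) t ∎
    where open ≡-Reasoning

  -[x+y-z]≡-x+-y-[-z] : ∀ x y z → - ((x + y) - z) ≡ ((- x) + (- y)) - (- z)
  -[x+y-z]≡-x+-y-[-z] = solve-∀

  neg-⊕-⊖ : (a b c : Vec ℤ m) → neg' ((b ⊕ c) ⊖ a) ≡ (neg' b ⊕ neg' c) ⊖ neg' a
  neg-⊕-⊖ [] [] [] = refl
  neg-⊕-⊖ (x ∷ a) (y ∷ b) (z ∷ c) = cong₂ _∷_ (-[x+y-z]≡-x+-y-[-z] y z x) (neg-⊕-⊖ a b c)

  negRev-⊕-⊖ : (a b c : Vec ℤ m) → negRev ((b ⊕ c) ⊖ a) ≡ (negRev b ⊕ negRev c) ⊖ negRev a
  negRev-⊕-⊖ a b c = begin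
    reverse (neg' ((b ⊕ c) ⊖ a))                       ≡⟨ cong reverse (neg-⊕-⊖ a b c) ⟩
    reverse ((neg' b ⊕ neg' c) ⊖ neg' a)               ≡⟨ reverse-zipWith _-_ (neg' b ⊕ neg' c) (neg' a) ⟩
    reverse (neg' b ⊕ neg' c) ⊖ negRev a               ≡⟨ cong (_⊖ negRev a) (reverse-zipWith _+_ (neg' b) (neg' c)) ⟩
    (negRev b ⊕ negRev c) ⊖ negRev a                   ∎
    where open ≡-Reasoning

  negRev-localRule : (a b c : Vec ℤ m) → negRev (localRule a b c) ≡ localRule (negRev a) (negRev b) (negRev c)
  negRev-localRule a b c = trans (negRev-sort ((b ⊕ c) ⊖ a)) (cong sort (negRev-⊕-⊖ a b c))

  localRule-comm : (a b c : Vec ℤ m) → localRule a b c ≡ localRule a c b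
  localRule-comm a b c = cong (λ v → sort (v ⊖ a)) (Vec.zipWith-comm ℤ.+-comm b c)

  -x≡-[x+1]+1 : ∀ x → - x ≡ (- (x + 1ℤ)) + 1ℤ
  -x≡-[x+1]+1 = solve-∀

  -x≡-[x+0]+0 : ∀ x → - x ≡ (- (x + 0ℤ)) + 0ℤ
  -x≡-[x+0]+0 = solve-∀

  -x≡-[x-1]-1 : ∀ x → - x ≡ (- (x + -1ℤ)) + -1ℤ
  -x≡-[x-1]-1 = solve-∀

  neg-step : ∀ σ (a : Vec ℤ m) S → neg' a ≡ neg' (a ⊕ e σ S) ⊕ e σ S
  neg-step pos [] [] = refl
  neg-step neg [] [] = refl
  neg-step pos (x ∷ a) (true ∷ S) = cong₂ _∷_ (-x≡-[x+1]+1 x) (neg-step pos a S)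
  neg-step pos (x ∷ a) (false ∷ S) = cong₂ _∷_ (-x≡-[x+0]+0 x) (neg-step pos a S)
  neg-step neg (x ∷ a) (true ∷ S) = cong₂ _∷_ (-x≡-[x-1]-1 x) (neg-step neg a S)
  neg-step neg (x ∷ a) (false ∷ S) = cong₂ _∷_ (-x≡-[x+0]+0 x) (neg-step neg a S)

  negRev-step : Step a b → Step (negRev b) (negRev a)
  negRev-step {a = a} (σ , S , refl) = σ , reverse S , (begin
    reverse (neg' a)                                ≡⟨ cong reverse (neg-step σ a S) ⟩
    reverse (neg' (a ⊕ e σ S) ⊕ e σ S)              ≡⟨ reverse-zipWith _+_ (neg' (a ⊕ e σ S)) (e σ S) ⟩
    negRev (a ⊕ e σ S) ⊕ reverse (e σ S)            ≡⟨ cong (negRev (a ⊕ e σ S) ⊕_) (reverse-e σ) ⟩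
    negRev (a ⊕ e σ S) ⊕ e σ (reverse S)            ∎)
    where
    open ≡-Reasoning
    reverse-e : ∀ σ → reverse (e σ S) ≡ e σ (reverse S)
    reverse-e pos = sym (Vec.map-reverse _ S)
    reverse-e neg = sym (Vec.map-reverse _ S)

module GrowthDiagram where

  open LocalRule
  open import Data.Nat as ℕ using (zero; suc; _+_; _∸_; _≤_; _<_; z≤n; s≤s)
  import Data.Nat.Properties as ℕ
  open import Data.Nat.Tactic.RingSolver using (solve-∀)
  open import Data.Integer using (ℤ)
  open import Data.Vec using (Vec)
  open import Data.List as List using ([]; _∷_; length; _∷ʳ_)
  import Data.List.Properties as List
  open import Data.Product using (Σ; _,_; proj₁; proj₂)
  open import Data.Sum using (inj₁; inj₂)
  open import Relation.Binary.PropositionalEquality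
  open import Function using (_∘_)

  private variable
    A : Set
    r n k : ℕ

  cong₃ : ∀ {B C D : Set} (f : A → B → C → D) {x x′ y y′ z z′} →
    x ≡ x′ → y ≡ y′ → z ≡ z′ → f x y z ≡ f x′ y′ z′
  cong₃ f refl refl refl = refl

  ∸-suc : ∀ {n a} → a < n → n ∸ a ≡ suc (n ∸ suc a)
  ∸-suc {suc n} {zero} _ = refl
  ∸-suc {suc n} {suc a} (s≤s a<n) = ∸-suc a<n

  nthD-ext : ∀ (d : A) (xs ys : List A) → length xs ≡ length ys →
    (∀ k → k < length xs → nthD d xs k ≡ nthD d ys k) → xs ≡ ys
  nthD-ext d [] [] _ _ = refl
  nthD-ext d (x ∷ xs) (y ∷ ys) eq xs≡ys =
    cong₂ _∷_ (xs≡ys 0 (s≤s z≤n)) (nthD-ext d xs ys (ℕ.suc-injective eq) (λ k k< → xs≡ys (suc k) (s≤s k<)))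

  nthD-map : ∀ {B : Set} (dA : A) (dB : B) (f : A → B) (xs : List A) k → k < length xs →
    nthD dB (List.map f xs) k ≡ f (nthD dA xs k)
  nthD-map dA dB f (x ∷ xs) zero _ = refl
  nthD-map dA dB f (x ∷ xs) (suc k) (s≤s k<) = nthD-map dA dB f xs k k<

  nthD-∷ʳ-< : ∀ (d : A) (xs : List A) x k → k < length xs → nthD d (xs ∷ʳ x) k ≡ nthD d xs k
  nthD-∷ʳ-< d (y ∷ xs) x zero _ = refl
  nthD-∷ʳ-< d (y ∷ xs) x (suc k) (s≤s k<) = nthD-∷ʳ-< d xs x k k<

  nthD-∷ʳ-length : ∀ (d : A) (xs : List A) x → nthD d (xs ∷ʳ x) (length xs) ≡ x
  nthD-∷ʳ-length d [] x = refl
  nthD-∷ʳ-length d (y ∷ xs) x = nthD-∷ʳ-length d xs x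

  nthD-reverse : ∀ (d : A) (xs : List A) k → k < length xs →
    nthD d (List.reverse xs) k ≡ nthD d xs (length xs ∸ suc k)
  nthD-reverse d (x ∷ xs) k k< rewrite List.unfold-reverse x xs with ℕ.m≤n⇒m<n∨m≡n (ℕ.≤-pred k<)
  ... | inj₁ k<len = begin
    nthD d (List.reverse xs ∷ʳ x) k            ≡⟨ nthD-∷ʳ-< d (List.reverse xs) x k
                                                     (subst (k <_) (sym (List.length-reverse xs)) k<len) ⟩
    nthD d (List.reverse xs) k                 ≡⟨ nthD-reverse d xs k k<len ⟩
    nthD d xs (length xs ∸ suc k)              ≡⟨ cong (nthD d (x ∷ xs)) (∸-suc k<len) ⟨
    nthD d (x ∷ xs) (length xs ∸ k)            ∎
    where open ≡-Reasoning
  ... | inj₂ refl = begin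
    nthD d (List.reverse xs ∷ʳ x) k                       ≡⟨ cong (nthD d (List.reverse xs ∷ʳ x)) (List.length-reverse xs) ⟨
    nthD d (List.reverse xs ∷ʳ x) (length (List.reverse xs)) ≡⟨ nthD-∷ʳ-length d (List.reverse xs) x ⟩
    x                                                     ≡⟨ cong (nthD d (x ∷ xs)) (ℕ.n∸n≡0 (length xs)) ⟨
    nthD d (x ∷ xs) (length xs ∸ length xs)               ∎
    where open ≡-Reasoning

  nthD-applyUpTo : ∀ (d : A) (f : ℕ → A) m k → k < m → nthD d (List.applyUpTo f m) k ≡ f k
  nthD-applyUpTo d f (suc m) zero _ = refl
  nthD-applyUpTo d f (suc m) (suc k) (s≤s k<m) = nthD-applyUpTo d (f ∘ suc) m k k<m

  iter-suc : ∀ k (f : A → A) a → iter (suc k) f a ≡ iter k f (f a)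
  iter-suc zero f a = refl
  iter-suc (suc k) f a = cong f (iter-suc k f a)

  infix 25 _!_
  _!_ : List (Vec ℤ r) → ℕ → Vec ℤ r
  T ! k = nthD zeroV T k

  promGo-length : ∀ (prev : Vec ℤ r) T → length (promGo prev T) ≡ length T
  promGo-length prev [] = refl
  promGo-length prev (a ∷ []) = refl
  promGo-length prev (a ∷ b ∷ T) = cong suc (promGo-length _ (b ∷ T))

  promotion-length : (T : List (Vec ℤ r)) → length (promotion T) ≡ length T
  promotion-length [] = refl
  promotion-length (x ∷ T) = cong suc (promGo-length x T)

  promotion-head : (T : List (Vec ℤ r)) → promotion T ! 0 ≡ T ! 0
  promotion-head [] = refl
  promotion-head (x ∷ T) = refl

  promGo-last : ∀ (prev a : Vec ℤ r) T → (prev ∷ promGo prev (a ∷ T)) ! suc (length T) ≡ (a ∷ T) ! length T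
  promGo-last prev a [] = refl
  promGo-last prev a (b ∷ T) = promGo-last _ b T

  promotion-last : (T : List (Vec ℤ r)) → length T ≡ suc n → promotion T ! n ≡ T ! n
  promotion-last (x ∷ []) refl = refl
  promotion-last (x ∷ a ∷ T) refl = promGo-last x a T

  promGo-rule : ∀ (prev : Vec ℤ r) T k → suc k < length T →
    (prev ∷ promGo prev T) ! suc k ≡ localRule (T ! k) (T ! suc k) ((prev ∷ promGo prev T) ! k)
  promGo-rule prev (a ∷ b ∷ T) zero _ = refl
  promGo-rule prev (a ∷ b ∷ T) (suc k) (s≤s k<) = promGo-rule _ (b ∷ T) k k<
  promGo-rule prev (a ∷ []) k (s≤s ())

  promotion-rule : (T : List (Vec ℤ r)) → length T ≡ suc n → suc (suc k) ≤ n →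
    promotion T ! suc k ≡ localRule (T ! suc k) (T ! suc (suc k)) (promotion T ! k)
  promotion-rule {k = k} (x ∷ T) refl k< = promGo-rule x T k k<

  record IsTableau (n : ℕ) (T : List (Vec ℤ r)) : Set where
    field
      length≡ : length T ≡ suc n
      descending : ∀ k → k ≤ n → Descending (T ! k)
      step : ∀ k → k < n → Step (T ! k) (T ! suc k)

  fromFluctuating : (T : List (Vec ℤ r)) → IsFluctuatingTableau r n T → IsTableau n T
  fromFluctuating {n = n} T (length≡ , partitions , steps) = record
    { length≡ = length≡
    ; descending = λ k k≤n → descending T partitions k (subst (k <_) (sym length≡) (s≤s k≤n))
    ; step = λ k k<n → step T steps k (subst (suc k <_) (sym length≡) (s≤s k<n))
    }
    where
    descending : (T : List (Vec ℤ r)) → AllPartitions T → ∀ k → k < length T → Descending (T ! k)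
    descending (x ∷ T) (px , _) zero _ = isGenPartition⇒descending x px
    descending (x ∷ T) (_ , pT) (suc k) (s≤s k<) = descending T pT k k<
    step : (T : List (Vec ℤ r)) → Steps T → ∀ k → suc k < length T → Step (T ! k) (T ! suc k)
    step (x ∷ y ∷ T) (s , _) zero _ = s
    step (x ∷ y ∷ T) (_ , sT) (suc k) (s≤s k<) = step (y ∷ T) sT k k<
    step (x ∷ []) _ k (s≤s ())

  module _ {T : List (Vec ℤ r)} (tab : IsTableau n T) where
    open IsTableau tab

    promotion-column : ∀ k → k < n → Step (T ! suc k) (promotion T ! k) × Descending (promotion T ! k)
    promotion-square : ∀ k → suc k < n →
      let d = localRule (T ! suc k) (T ! suc (suc k)) (promotion T ! k) in
      Step (T ! suc (suc k)) d × Step (promotion T ! k) d × localRule d (T ! suc (suc k)) (promotion T ! k) ≡ T ! suc k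

    promotion-column zero 0<n =
      subst (λ v → Step (T ! 1) v × Descending v) (sym (promotion-head T)) (step-sym (step 0 0<n) , descending 0 z≤n)
    promotion-column (suc k) k+1<n =
      subst (λ v → Step (T ! suc (suc k)) v × Descending v) (sym (promotion-rule T length≡ k+1<n))
        (proj₁ (promotion-square k k+1<n) , sort-descending ((T ! suc (suc k) ⊕ promotion T ! k) ⊖ T ! suc k))

    promotion-square k k+1<n = localRule-square (descending (suc k) k<n) (descending (suc (suc k)) k+1<n)
      (proj₂ (promotion-column k k<n)) (step (suc k) k+1<n) (proj₁ (promotion-column k k<n))
      where
      k<n : k < n
      k<n = ℕ.<⇒≤ k+1<n

    promotion-isTableau : IsTableau n (promotion T)
    promotion-isTableau = record
      { length≡ = trans (promotion-length T) length≡
      ; descending = descending′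
      ; step = step′
      }
      where
      descending′ : ∀ k → k ≤ n → Descending (promotion T ! k)
      descending′ k k≤n with ℕ.m≤n⇒m<n∨m≡n k≤n
      ... | inj₁ k<n = proj₂ (promotion-column k k<n)
      ... | inj₂ refl = subst Descending (sym (promotion-last T length≡)) (descending k k≤n)
      step′ : ∀ k → k < n → Step (promotion T ! k) (promotion T ! suc k)
      step′ k k<n with ℕ.m≤n⇒m<n∨m≡n k<n
      ... | inj₁ k+1<n = subst (Step (promotion T ! k)) (sym (promotion-rule T length≡ k+1<n))
                           (proj₁ (proj₂ (promotion-square k k+1<n)))
      ... | inj₂ refl = subst (Step (promotion T ! k)) (sym (promotion-last T length≡))
                          (step-sym (proj₁ (promotion-column k k<n)))

    promotion-rule⁻¹ : ∀ k → suc (suc k) ≤ n →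
      T ! suc k ≡ localRule (promotion T ! suc k) (T ! suc (suc k)) (promotion T ! k)
    promotion-rule⁻¹ k k+1<n = begin
      T ! suc k
        ≡⟨ proj₂ (proj₂ (promotion-square k k+1<n)) ⟨
      localRule (localRule (T ! suc k) (T ! suc (suc k)) (promotion T ! k)) (T ! suc (suc k)) (promotion T ! k)
        ≡⟨ cong (λ d → localRule d (T ! suc (suc k)) (promotion T ! k)) (promotion-rule T length≡ k+1<n) ⟨
      localRule (promotion T ! suc k) (T ! suc (suc k)) (promotion T ! k) ∎
      where open ≡-Reasoning

  TriangleRule : ℕ → (ℕ → ℕ → Vec ℤ r) → Set
  TriangleRule n F = ∀ i k → suc i + suc k ≤ n →
    F (suc i) (suc k) ≡ localRule (F i (suc k)) (F i (suc (suc k))) (F (suc i) k)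

  i+[k+2]≡[i+1]+[k+1] : ∀ i k → i + suc (suc k) ≡ suc i + suc k
  i+[k+2]≡[i+1]+[k+1] = solve-∀

  triangleRule-unique : ∀ n (F G : ℕ → ℕ → Vec ℤ r) →
    (∀ k → k ≤ n → F 0 k ≡ G 0 k) → (∀ i → i ≤ n → F i 0 ≡ G i 0) →
    TriangleRule n F → TriangleRule n G → ∀ i k → i + k ≤ n → F i k ≡ G i k
  triangleRule-unique n F G row col rule-F rule-G = go
    where
    go : ∀ i k → i + k ≤ n → F i k ≡ G i k
    go zero k k≤n = row k k≤n
    go (suc i) zero i+1≤n = col (suc i) (subst (_≤ n) (ℕ.+-identityʳ (suc i)) i+1≤n)
    go (suc i) (suc k) h = begin
      F (suc i) (suc k)                                        ≡⟨ rule-F i k h ⟩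
      localRule (F i (suc k)) (F i (suc (suc k))) (F (suc i) k) ≡⟨ cong₃ localRule (go i (suc k) h₁) (go i (suc (suc k)) h₂) (go (suc i) k h₃) ⟩
      localRule (G i (suc k)) (G i (suc (suc k))) (G (suc i) k) ≡⟨ rule-G i k h ⟨
      G (suc i) (suc k)                                        ∎
      where
      open ≡-Reasoning
      h₂ : i + suc (suc k) ≤ n
      h₂ = subst (_≤ n) (sym (i+[k+2]≡[i+1]+[k+1] i k)) h
      h₁ : i + suc k ≤ n
      h₁ = ℕ.≤-trans (ℕ.+-monoʳ-≤ i (ℕ.n≤1+n (suc k))) h₂
      h₃ : suc i + k ≤ n
      h₃ = ℕ.≤-trans (ℕ.+-monoʳ-≤ (suc i) (ℕ.n≤1+n k)) h

  DualTriangleRule : ℕ → (ℕ → ℕ → Vec ℤ r) → Set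
  DualTriangleRule n D = ∀ k j → suc (suc (k + j)) ≤ n →
    D (suc k) j ≡ localRule (D k (suc j)) (D (suc k) (suc j)) (D k j)

  [k+1]+[j+1]+m≡[k+1]+j+[m+1] : ∀ k j m → suc k + suc j + m ≡ suc k + j + suc m
  [k+1]+[j+1]+m≡[k+1]+j+[m+1] = solve-∀

  k+j+[m+2]≡[k+1]+j+[m+1] : ∀ k j m → k + j + suc (suc m) ≡ suc k + j + suc m
  k+j+[m+2]≡[k+1]+j+[m+1] = solve-∀

  k+[j+1]+[m+1]≡[k+1]+j+[m+1] : ∀ k j m → k + suc j + suc m ≡ suc k + j + suc m
  k+[j+1]+[m+1]≡[k+1]+j+[m+1] = solve-∀

  [k+1]+j+[m+1]≡[k+j+2]+m : ∀ k j m → suc k + j + suc m ≡ suc (suc (k + j)) + m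
  [k+1]+j+[m+1]≡[k+j+2]+m = solve-∀

  dualTriangleRule-unique : ∀ n (D E : ℕ → ℕ → Vec ℤ r) →
    (∀ j → j ≤ n → D 0 j ≡ E 0 j) → (∀ k j → k + j ≡ n → D k j ≡ E k j) →
    DualTriangleRule n D → DualTriangleRule n E → ∀ k m j → k + j + m ≡ n → D k j ≡ E k j
  dualTriangleRule-unique n D E row diagonal rule-D rule-E = go
    where
    go : ∀ k m j → k + j + m ≡ n → D k j ≡ E k j
    go zero m j j+m≡n = row j (subst (j ≤_) j+m≡n (ℕ.m≤m+n j m))
    go (suc k) zero j h = diagonal (suc k) j (trans (sym (ℕ.+-identityʳ (suc k + j))) h)
    go (suc k) (suc m) j h = begin
      D (suc k) j                                              ≡⟨ rule-D k j k+j+2≤n ⟩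
      localRule (D k (suc j)) (D (suc k) (suc j)) (D k j)       ≡⟨ cong₃ localRule
        (go k (suc m) (suc j) (trans (k+[j+1]+[m+1]≡[k+1]+j+[m+1] k j m) h))
        (go (suc k) m (suc j) (trans ([k+1]+[j+1]+m≡[k+1]+j+[m+1] k j m) h))
        (go k (suc (suc m)) j (trans (k+j+[m+2]≡[k+1]+j+[m+1] k j m) h)) ⟩
      localRule (E k (suc j)) (E (suc k) (suc j)) (E k j)       ≡⟨ rule-E k j k+j+2≤n ⟨
      E (suc k) j                                              ∎
      where
      open ≡-Reasoning
      k+j+2≤n : suc (suc (k + j)) ≤ n
      k+j+2≤n = subst (suc (suc (k + j)) ≤_) (trans (sym ([k+1]+j+[m+1]≡[k+j+2]+m k j m)) h) (ℕ.m≤m+n _ m)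

  -- Entry (i, k) is λ^{i,i+k}: rows are indexed by i and columns by the offset k = j − i.
  promotionDiagram : List (Vec ℤ r) → ℕ → ℕ → Vec ℤ r
  promotionDiagram T i k = iter i promotion T ! k

  module _ {T : List (Vec ℤ r)} (length≡ : length T ≡ suc n) where

    iter-promotion-length : ∀ i → length (iter i promotion T) ≡ suc n
    iter-promotion-length zero = length≡
    iter-promotion-length (suc i) = trans (promotion-length (iter i promotion T)) (iter-promotion-length i)

    promotionDiagram-first : ∀ i → promotionDiagram T i 0 ≡ T ! 0
    promotionDiagram-first zero = refl
    promotionDiagram-first (suc i) = trans (promotion-head (iter i promotion T)) (promotionDiagram-first i)

    promotionDiagram-last : ∀ i → promotionDiagram T i n ≡ T ! n
    promotionDiagram-last zero = refl
    promotionDiagram-last (suc i) =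
      trans (promotion-last (iter i promotion T) (iter-promotion-length i)) (promotionDiagram-last i)

    promotionDiagram-rule : TriangleRule n (promotionDiagram T)
    promotionDiagram-rule i k h = promotion-rule (iter i promotion T) (iter-promotion-length i)
      (ℕ.≤-trans (s≤s (s≤s (ℕ.m≤n+m k i))) (subst (_≤ n) (cong suc (ℕ.+-suc i k)) h))

  module _ {T : List (Vec ℤ r)} (tab : IsTableau n T) where

    iter-promotion-isTableau : ∀ i → IsTableau n (iter i promotion T)
    iter-promotion-isTableau zero = tab
    iter-promotion-isTableau (suc i) = promotion-isTableau (iter-promotion-isTableau i)

    promotionDiagram-rule⁻¹ : ∀ i k → suc (suc k) ≤ n →
      promotionDiagram T i (suc k)
        ≡ localRule (promotionDiagram T (suc i) (suc k)) (promotionDiagram T i (suc (suc k))) (promotionDiagram T (suc i) k)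
    promotionDiagram-rule⁻¹ i = promotion-rule⁻¹ (iter-promotion-isTableau i)

  dualStep-length : (L : List (Vec ℤ r)) → length (dualStep L) ≡ ℕ.pred (length L)
  dualStep-length [] = refl
  dualStep-length (x ∷ []) = refl
  dualStep-length (x ∷ y ∷ L) with dualStep (y ∷ L) | dualStep-length (y ∷ L)
  ... | [] | eq = cong suc eq
  ... | _ ∷ _ | eq = cong suc eq

  dualStep-∷ : ∀ (x y z : Vec ℤ r) L → Σ (Vec ℤ r) λ h → Σ (List (Vec ℤ r)) λ hs →
    dualStep (y ∷ z ∷ L) ≡ h ∷ hs × dualStep (x ∷ y ∷ z ∷ L) ≡ localRule y h x ∷ h ∷ hs
  dualStep-∷ x y z L with dualStep (y ∷ z ∷ L) | dualStep-length (y ∷ z ∷ L)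
  ... | h ∷ hs | _ = h , hs , refl , refl

  dualStep-last : ∀ (x y : Vec ℤ r) L → dualStep (x ∷ y ∷ L) ! length L ≡ (y ∷ L) ! length L
  dualStep-last x y [] = refl
  dualStep-last x y (z ∷ L) with dualStep-∷ x y z L
  ... | h , hs , eq , eq′ rewrite eq′ = trans (cong (_! length L) (sym eq)) (dualStep-last y z L)

  dualStep-rule : (L : List (Vec ℤ r)) → ∀ j → suc (suc j) < length L →
    dualStep L ! j ≡ localRule (L ! suc j) (dualStep L ! suc j) (L ! j)
  dualStep-rule (x ∷ y ∷ []) j (s≤s (s≤s ()))
  dualStep-rule (x ∷ y ∷ z ∷ L) zero _ with dualStep-∷ x y z L
  ... | h , hs , eq , eq′ rewrite eq′ = refl
  dualStep-rule (x ∷ y ∷ z ∷ L) (suc j) (s≤s j+2<) with dualStep-∷ x y z L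
  ... | h , hs , eq , eq′ rewrite eq′ =
    subst (λ u → u ! j ≡ localRule ((y ∷ z ∷ L) ! suc j) (u ! suc j) ((y ∷ z ∷ L) ! j)) eq
      (dualStep-rule (y ∷ z ∷ L) j j+2<)

  -- Entry (k, j) is μ^{−k,j}.
  dualDiagram : List (Vec ℤ r) → ℕ → ℕ → Vec ℤ r
  dualDiagram T k j = iter k dualStep T ! j

  module _ {T : List (Vec ℤ r)} (length≡ : length T ≡ suc n) where

    iter-dualStep-length : ∀ k m → k + m ≡ n → length (iter k dualStep T) ≡ suc m
    iter-dualStep-length zero m m≡n = trans length≡ (cong suc (sym m≡n))
    iter-dualStep-length (suc k) m k+1+m≡n =
      trans (dualStep-length (iter k dualStep T))
            (cong ℕ.pred (iter-dualStep-length k (suc m) (trans (ℕ.+-suc k m) k+1+m≡n)))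

    dualDiagram-diagonal : ∀ k m → k + m ≡ n → dualDiagram T k m ≡ T ! n
    dualDiagram-diagonal zero m m≡n = cong (T !_) m≡n
    dualDiagram-diagonal (suc k) m h
      with iter k dualStep T | iter-dualStep-length k (suc m) (trans (ℕ.+-suc k m) h)
         | dualDiagram-diagonal k (suc m) (trans (ℕ.+-suc k m) h)
    ... | x ∷ y ∷ L | length≡′ | previous =
      trans (subst (λ q → dualStep (x ∷ y ∷ L) ! q ≡ (y ∷ L) ! q) (ℕ.suc-injective (ℕ.suc-injective length≡′))
                   (dualStep-last x y L))
            previous

    dualDiagram-rule : DualTriangleRule n (dualDiagram T)
    dualDiagram-rule k j h = dualStep-rule (iter k dualStep T) j
      (subst (suc (suc j) <_) (sym (iter-dualStep-length k (n ∸ k) (ℕ.m+[n∸m]≡n k≤n)))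
        (s≤s (ℕ.+-cancelˡ-≤ k _ _ (subst (_≤ k + (n ∸ k)) (sym k+j+2≡) (subst (suc (suc (k + j)) ≤_) (sym (ℕ.m+[n∸m]≡n k≤n)) h)))))
      where
      k≤n : k ≤ n
      k≤n = ℕ.≤-trans (ℕ.m≤m+n k j) (ℕ.≤-trans (ℕ.n≤1+n _) (ℕ.<⇒≤ h))
      k+j+2≡ : k + suc (suc j) ≡ suc (suc (k + j))
      k+j+2≡ = trans (ℕ.+-suc k (suc j)) (cong suc (ℕ.+-suc k j))

  evacuation-length : ∀ n (T : List (Vec ℤ r)) → length (evacuation n T) ≡ suc n
  evacuation-length n T = trans (List.length-map (λ k → grid T (n ∸ k) n) (List.upTo (suc n)))
                                (List.length-applyUpTo (λ i → i) (suc n))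

  evacuation-! : ∀ n (T : List (Vec ℤ r)) k → k ≤ n → evacuation n T ! k ≡ promotionDiagram T (n ∸ k) k
  evacuation-! n T k k≤n = begin
    evacuation n T ! k                          ≡⟨ nthD-map 0 zeroV (λ k → grid T (n ∸ k) n) (List.upTo (suc n)) k
                                                     (subst (k <_) (sym (List.length-applyUpTo (λ i → i) (suc n))) (s≤s k≤n)) ⟩
    grid T (n ∸ nthD 0 (List.upTo (suc n)) k) n ≡⟨ cong (λ q → grid T (n ∸ q) n) (nthD-applyUpTo 0 (λ i → i) (suc n) k (s≤s k≤n)) ⟩
    iter (n ∸ k) promotion T ! (n ∸ (n ∸ k))    ≡⟨ cong (iter (n ∸ k) promotion T !_) (ℕ.m∸[m∸n]≡n k≤n) ⟩
    promotionDiagram T (n ∸ k) k                ∎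
    where open ≡-Reasoning

  dualEvacGo-length : ∀ n (T : List (Vec ℤ r)) → length (dualEvacGo n T) ≡ suc n
  dualEvacGo-length zero T = refl
  dualEvacGo-length (suc n) T = cong suc (dualEvacGo-length n (dualStep T))

  headD≡!0 : (L : List (Vec ℤ r)) → headD L ≡ L ! 0
  headD≡!0 [] = refl
  headD≡!0 (x ∷ L) = refl

  dualEvacGo-! : ∀ n (T : List (Vec ℤ r)) k → k ≤ n → dualEvacGo n T ! k ≡ dualDiagram T k 0
  dualEvacGo-! zero T zero _ = headD≡!0 T
  dualEvacGo-! (suc n) T zero _ = headD≡!0 T
  dualEvacGo-! (suc n) T (suc k) (s≤s k≤n) =
    trans (dualEvacGo-! n (dualStep T) k k≤n) (cong (_! 0) (sym (iter-suc k dualStep T)))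

  epsilon-length : (T : List (Vec ℤ r)) → length (epsilon T) ≡ length T
  epsilon-length T = trans (List.length-reverse (List.map negRev T)) (List.length-map negRev T)

  epsilon-! : (T : List (Vec ℤ r)) → length T ≡ suc n → ∀ k → k ≤ n → epsilon T ! k ≡ negRev (T ! (n ∸ k))
  epsilon-! {n = n} T length≡ k k≤n = begin
    nthD zeroV (List.reverse (List.map negRev T)) k
      ≡⟨ nthD-reverse zeroV (List.map negRev T) k (subst (k <_) (sym (trans (List.length-map negRev T) length≡)) (s≤s k≤n)) ⟩
    nthD zeroV (List.map negRev T) (length (List.map negRev T) ∸ suc k)
      ≡⟨ cong (λ l → nthD zeroV (List.map negRev T) (l ∸ suc k)) (trans (List.length-map negRev T) length≡) ⟩
    nthD zeroV (List.map negRev T) (n ∸ k)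
      ≡⟨ nthD-map zeroV zeroV negRev T (n ∸ k) (subst (n ∸ k <_) (sym length≡) (s≤s (ℕ.m∸n≤m n k))) ⟩
    negRev (T ! (n ∸ k)) ∎
    where open ≡-Reasoning

  epsilon-involutive : (T : List (Vec ℤ r)) → epsilon (epsilon T) ≡ T
  epsilon-involutive T = begin
    List.reverse (List.map negRev (List.reverse (List.map negRev T))) ≡⟨ cong List.reverse (List.reverse-map negRev (List.map negRev T)) ⟩
    List.reverse (List.reverse (List.map negRev (List.map negRev T))) ≡⟨ List.reverse-involutive _ ⟩
    List.map negRev (List.map negRev T)                               ≡⟨ List.map-∘ T ⟨
    List.map (λ v → negRev (negRev v)) T                              ≡⟨ List.map-cong negRev-involutive T ⟩
    List.map (λ v → v) T                                              ≡⟨ List.map-id T ⟩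
    T                                                                 ∎
    where open ≡-Reasoning

  epsilon-injective : (T U : List (Vec ℤ r)) → epsilon T ≡ epsilon U → T ≡ U
  epsilon-injective T U eq = trans (sym (epsilon-involutive T)) (trans (cong epsilon eq) (epsilon-involutive U))

  epsilon-isTableau : {T : List (Vec ℤ r)} → IsTableau n T → IsTableau n (epsilon T)
  epsilon-isTableau {n = n} {T} tab = record
    { length≡ = trans (epsilon-length T) length≡
    ; descending = λ k k≤n → subst Descending (sym (epsilon-! T length≡ k k≤n))
                                 (negRev-descending (descending (n ∸ k) (ℕ.m∸n≤m n k)))
    ; step = λ k k<n → subst₂ Step (sym (epsilon-! T length≡ k (ℕ.<⇒≤ k<n))) (sym (epsilon-! T length≡ (suc k) k<n))
                         (subst (λ q → Step (negRev (T ! q)) (negRev (T ! (n ∸ suc k)))) (sym (∸-suc k<n))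
                           (negRev-step (step (n ∸ suc k) (subst (_≤ n) (∸-suc k<n) (ℕ.m∸n≤m n k)))))
    }
    where open IsTableau tab

  -- Reflecting the triangle i + k ≤ n sends row i to row n − (i + k).
  module Reflect (n i k : ℕ) (h : suc i + suc k ≤ n) where
    j : ℕ
    j = n ∸ (suc i + suc k)

    row-i,k+2 : n ∸ (i + suc (suc k)) ≡ j
    row-i,k+2 = cong (n ∸_) (i+[k+2]≡[i+1]+[k+1] i k)

    row-i+1,k : n ∸ (suc i + k) ≡ suc j
    row-i+1,k = trans (∸-suc (subst (_≤ n) (ℕ.+-suc (suc i) k) h)) (cong (λ q → suc (n ∸ q)) (sym (ℕ.+-suc (suc i) k)))

    row-i,k+1 : n ∸ (i + suc k) ≡ suc j
    row-i,k+1 = trans (cong (n ∸_) (ℕ.+-suc i k)) row-i+1,k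

    k+2≤n : suc (suc k) ≤ n
    k+2≤n = ℕ.≤-trans (s≤s (s≤s (ℕ.m≤n+m k i))) (subst (_≤ n) (cong suc (ℕ.+-suc i k)) h)

    i+j+2≤n : suc (suc (i + j)) ≤ n
    i+j+2≤n = subst (suc (suc (i + j)) ≤_) (trans (sym (lemma i k j)) (ℕ.m+[n∸m]≡n h)) (ℕ.m≤m+n _ k)
      where
      lemma : ∀ i k j → suc i + suc k + j ≡ suc (suc (i + j)) + k
      lemma = solve-∀

  evacuation-involutive : {T : List (Vec ℤ r)} → IsTableau n T → evacuation n (evacuation n T) ≡ T
  evacuation-involutive {n = n} {T} tab =
    nthD-ext zeroV (evacuation n (evacuation n T)) T (trans (evacuation-length n (evacuation n T)) (sym length≡)) λ k k< →
      let k≤n = ℕ.≤-pred (subst (k <_) (evacuation-length n (evacuation n T)) k<) in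
      begin
        evacuation n (evacuation n T) ! k                 ≡⟨ evacuation-! n _ k k≤n ⟩
        promotionDiagram (evacuation n T) (n ∸ k) k       ≡⟨ reflected (n ∸ k) k (ℕ.≤-reflexive (ℕ.m∸n+n≡m k≤n)) ⟩
        promotionDiagram T (n ∸ ((n ∸ k) + k)) k          ≡⟨ cong (λ q → promotionDiagram T (n ∸ q) k) (ℕ.m∸n+n≡m k≤n) ⟩
        promotionDiagram T (n ∸ n) k                      ≡⟨ cong (λ q → promotionDiagram T q k) (ℕ.n∸n≡0 n) ⟩
        T ! k                                             ∎
    where
    open ≡-Reasoning
    open IsTableau tab
    R : ℕ → ℕ → Vec ℤ _
    R = promotionDiagram T
    reflected : ∀ i k → i + k ≤ n → promotionDiagram (evacuation n T) i k ≡ R (n ∸ (i + k)) k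
    reflected = triangleRule-unique n (promotionDiagram (evacuation n T)) (λ i k → R (n ∸ (i + k)) k)
      (λ k k≤n → evacuation-! n T k k≤n)
      (λ i i≤n → trans (promotionDiagram-first (evacuation-length n T) i)
                 (trans (evacuation-! n T 0 z≤n)
                 (trans (promotionDiagram-first length≡ n) (sym (promotionDiagram-first length≡ (n ∸ (i + 0)))))))
      (promotionDiagram-rule (evacuation-length n T))
      λ i k h → let open Reflect n i k h in
        trans (promotionDiagram-rule⁻¹ tab j k k+2≤n)
              (sym (cong₃ localRule (cong (λ q → R q (suc k)) row-i,k+1)
                                    (cong (λ q → R q (suc (suc k))) row-i,k+2)
                                    (cong (λ q → R q k) row-i+1,k)))

  evacuation-epsilon : {T : List (Vec ℤ r)} → length T ≡ suc n →
    evacuation n (epsilon T) ≡ epsilon (dualEvacuation n T)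
  evacuation-epsilon {n = n} {T} length≡ =
    nthD-ext zeroV (evacuation n (epsilon T)) (epsilon (dualEvacuation n T))
      (trans (evacuation-length n (epsilon T)) (sym (trans (epsilon-length (dualEvacuation n T)) (dualEvacGo-length n T)))) λ k k< →
      let k≤n = ℕ.≤-pred (subst (k <_) (evacuation-length n (epsilon T)) k<) in
      begin
        evacuation n (epsilon T) ! k                   ≡⟨ evacuation-! n _ k k≤n ⟩
        promotionDiagram (epsilon T) (n ∸ k) k         ≡⟨ reflected (n ∸ k) k (ℕ.≤-reflexive (ℕ.m∸n+n≡m k≤n)) ⟩
        negRev (D (n ∸ k) (n ∸ ((n ∸ k) + k)))         ≡⟨ cong (λ q → negRev (D (n ∸ k) q)) (trans (cong (n ∸_) (ℕ.m∸n+n≡m k≤n)) (ℕ.n∸n≡0 n)) ⟩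
        negRev (D (n ∸ k) 0)                           ≡⟨ cong negRev (dualEvacGo-! n T (n ∸ k) (ℕ.m∸n≤m n k)) ⟨
        negRev (dualEvacuation n T ! (n ∸ k))          ≡⟨ epsilon-! (dualEvacuation n T) (dualEvacGo-length n T) k k≤n ⟨
        epsilon (dualEvacuation n T) ! k               ∎
    where
    open ≡-Reasoning
    D : ℕ → ℕ → Vec ℤ _
    D = dualDiagram T
    H : ℕ → ℕ → Vec ℤ _
    H i k = negRev (D i (n ∸ (i + k)))
    reflected : ∀ i k → i + k ≤ n → promotionDiagram (epsilon T) i k ≡ H i k
    reflected = triangleRule-unique n (promotionDiagram (epsilon T)) H
      (λ k k≤n → epsilon-! T length≡ k k≤n)
      (λ i i≤n → trans (promotionDiagram-first (trans (epsilon-length T) length≡) i)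
                 (trans (epsilon-! T length≡ 0 z≤n)
                 (cong negRev (sym (dualDiagram-diagonal length≡ i (n ∸ (i + 0))
                   (trans (cong (λ q → i + (n ∸ q)) (ℕ.+-identityʳ i)) (ℕ.m+[n∸m]≡n i≤n)))))))
      (promotionDiagram-rule (trans (epsilon-length T) length≡))
      λ i k h → let open Reflect n i k h in begin
        negRev (D (suc i) j)
          ≡⟨ cong negRev (dualDiagram-rule length≡ i j i+j+2≤n) ⟩
        negRev (localRule (D i (suc j)) (D (suc i) (suc j)) (D i j))
          ≡⟨ negRev-localRule (D i (suc j)) (D (suc i) (suc j)) (D i j) ⟩
        localRule (negRev (D i (suc j))) (negRev (D (suc i) (suc j))) (negRev (D i j))
          ≡⟨ localRule-comm (negRev (D i (suc j))) (negRev (D (suc i) (suc j))) (negRev (D i j)) ⟩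
        localRule (negRev (D i (suc j))) (negRev (D i j)) (negRev (D (suc i) (suc j)))
          ≡⟨ cong₃ localRule (cong (λ q → negRev (D i q)) row-i,k+1)
                             (cong (λ q → negRev (D i q)) row-i,k+2)
                             (cong (λ q → negRev (D (suc i) q)) row-i+1,k) ⟨
        localRule (H i (suc k)) (H i (suc (suc k))) (H (suc i) k) ∎

  dualEvacuation-promotion : {T : List (Vec ℤ r)} → IsTableau n T →
    dualEvacuation n (iter n promotion T) ≡ evacuation n T
  dualEvacuation-promotion {n = n} {T} tab =
    nthD-ext zeroV (dualEvacuation n (iter n promotion T)) (evacuation n T)
      (trans (dualEvacGo-length n (iter n promotion T)) (sym (evacuation-length n T))) λ k k< →
      let k≤n = ℕ.≤-pred (subst (k <_) (dualEvacGo-length n (iter n promotion T)) k<) in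
      begin
        dualEvacuation n (iter n promotion T) ! k   ≡⟨ dualEvacGo-! n _ k k≤n ⟩
        dualDiagram (iter n promotion T) k 0        ≡⟨ agree k (n ∸ k) 0 (trans (cong (_+ (n ∸ k)) (ℕ.+-identityʳ k)) (ℕ.m+[n∸m]≡n k≤n)) ⟩
        R (n ∸ k) (k + 0)                           ≡⟨ cong (R (n ∸ k)) (ℕ.+-identityʳ k) ⟩
        R (n ∸ k) k                                 ≡⟨ evacuation-! n T k k≤n ⟨
        evacuation n T ! k                          ∎
    where
    open ≡-Reasoning
    open IsTableau tab
    R : ℕ → ℕ → Vec ℤ _
    R = promotionDiagram T
    agree : ∀ k m j → k + j + m ≡ n → dualDiagram (iter n promotion T) k j ≡ R (n ∸ k) (k + j)
    agree = dualTriangleRule-unique n (dualDiagram (iter n promotion T)) (λ k j → R (n ∸ k) (k + j))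
      (λ j _ → refl)
      (λ k j k+j≡n → trans (dualDiagram-diagonal (iter-promotion-length length≡ n) k j k+j≡n)
                     (trans (promotionDiagram-last length≡ n)
                            (sym (trans (cong (R (n ∸ k)) k+j≡n) (promotionDiagram-last length≡ (n ∸ k))))))
      (dualDiagram-rule (iter-promotion-length length≡ n))
      λ k j k+j+2≤n →
        let m = n ∸ suc k
            n-k≡m+1 : n ∸ k ≡ suc m
            n-k≡m+1 = ∸-suc (ℕ.≤-trans (s≤s (ℕ.m≤m+n k j)) (ℕ.<⇒≤ k+j+2≤n))
        in begin
          R m (suc (k + j))
            ≡⟨ promotionDiagram-rule⁻¹ tab m (k + j) k+j+2≤n ⟩
          localRule (R (suc m) (suc (k + j))) (R m (suc (suc (k + j)))) (R (suc m) (k + j))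
            ≡⟨ cong₃ localRule (cong₂ R n-k≡m+1 (ℕ.+-suc k j)) (cong (R m) (cong suc (ℕ.+-suc k j))) (cong (λ q → R q (k + j)) n-k≡m+1) ⟨
          localRule (R (n ∸ k) (k + suc j)) (R m (suc k + suc j)) (R (n ∸ k) (k + j)) ∎

  module _ {T : List (Vec ℤ r)} (tab : IsTableau n T) where
    open IsTableau tab using (length≡)
    open ≡-Reasoning

    evacuation≡epsilon⇒dualEvacuation≡epsilon : evacuation n T ≡ epsilon T → dualEvacuation n T ≡ epsilon T
    evacuation≡epsilon⇒dualEvacuation≡epsilon E≡ε = epsilon-injective _ _ (begin
      epsilon (dualEvacuation n T)       ≡⟨ evacuation-epsilon length≡ ⟨
      evacuation n (epsilon T)           ≡⟨ cong (evacuation n) E≡ε ⟨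
      evacuation n (evacuation n T)      ≡⟨ evacuation-involutive tab ⟩
      T                                  ≡⟨ epsilon-involutive T ⟨
      epsilon (epsilon T)                ∎)

    dualEvacuation≡epsilon⇒evacuation≡epsilon : dualEvacuation n T ≡ epsilon T → evacuation n T ≡ epsilon T
    dualEvacuation≡epsilon⇒evacuation≡epsilon E*≡ε = begin
      evacuation n T                             ≡⟨ cong (evacuation n) (trans (cong epsilon E*≡ε) (epsilon-involutive T)) ⟨
      evacuation n (epsilon (dualEvacuation n T)) ≡⟨ cong (evacuation n) (evacuation-epsilon length≡) ⟨
      evacuation n (evacuation n (epsilon T))    ≡⟨ evacuation-involutive (epsilon-isTableau tab) ⟩
      epsilon T                                  ∎

    evacuation≡dualEvacuation⇒promotionⁿ≡id : evacuation n T ≡ dualEvacuation n T → iter n promotion T ≡ T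
    evacuation≡dualEvacuation⇒promotionⁿ≡id E≡E* = epsilon-injective _ _ (begin
      epsilon Pⁿ                                  ≡⟨ evacuation-involutive (epsilon-isTableau Pⁿtab) ⟨
      evacuation n (evacuation n (epsilon Pⁿ))    ≡⟨ cong (evacuation n) (evacuation-epsilon (IsTableau.length≡ Pⁿtab)) ⟩
      evacuation n (epsilon (dualEvacuation n Pⁿ)) ≡⟨ cong (evacuation n ∘ epsilon) (trans (dualEvacuation-promotion tab) E≡E*) ⟩
      evacuation n (epsilon (dualEvacuation n T)) ≡⟨ cong (evacuation n) (evacuation-epsilon length≡) ⟨
      evacuation n (evacuation n (epsilon T))     ≡⟨ evacuation-involutive (epsilon-isTableau tab) ⟩
      epsilon T                                   ∎)
      where
      Pⁿ : List (Vec ℤ _)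
      Pⁿ = iter n promotion T
      Pⁿtab : IsTableau n Pⁿ
      Pⁿtab = iter-promotion-isTableau tab n

    promotionⁿ≡id⇒evacuation≡dualEvacuation : iter n promotion T ≡ T → evacuation n T ≡ dualEvacuation n T
    promotionⁿ≡id⇒evacuation≡dualEvacuation Pⁿ≡id = trans (sym (dualEvacuation-promotion tab)) (cong (dualEvacuation n) Pⁿ≡id)

open GrowthDiagram
open import Data.Product using (_,_)
open import Function.Bundles using (mk⇔)
open import Relation.Binary.PropositionalEquality using (sym; trans)

lemma3p14 : (r n : ℕ) (T : List (Vecℤ r)) → IsFluctuatingTableau r n T →
    ((evacuation n T ≡ epsilon T) ⇔ (dualEvacuation n T ≡ epsilon T))
    × ((evacuation n T ≡ epsilon T) → evacuation n T ≡ dualEvacuation n T)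
    × ((evacuation n T ≡ dualEvacuation n T) ⇔ (iter n promotion T ≡ T))
lemma3p14 r n T fluctuating =
  mk⇔ (evacuation≡epsilon⇒dualEvacuation≡epsilon tab) (dualEvacuation≡epsilon⇒evacuation≡epsilon tab) ,
  (λ E≡ε → trans E≡ε (sym (evacuation≡epsilon⇒dualEvacuation≡epsilon tab E≡ε))) ,
  mk⇔ (evacuation≡dualEvacuation⇒promotionⁿ≡id tab) (promotionⁿ≡id⇒evacuation≡dualEvacuation tab)
  where
  tab : IsTableau n T
  tab = fromFluctuating T fluctuating
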